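{- Let $R_3(n)$ denote the number of reduced $3$-by-$n$ Latin rectangles on $\{1,\dots,n\}$, $n\ge 1$. Define $g(t_{00},t_{10},t_{01},t_{11})=(t_{00}+t_{10})(t_{00}+t_{01})-t_{00}$. Then \begin{align*} R_3(n)=\sum_{s_{00}+s_{10}+s_{01}+s_{11}=n}&(-1)^{s_{10}+s_{01}+2s_{11}}\binom{n}{s_{00},s_{10},s_{01},s_{11}}\\ &\cdot g(s_{00}-1,s_{10},s_{01},s_{11}+1)^{s_{00}}\,g(s_{00},s_{10}-1,s_{01},s_{11}+1)^{s_{10}}\\ &\cdot g(s_{00},s_{10},s_{01}-1,s_{11}+1)^{s_{01}}\,g(s_{00},s_{10},s_{01},s_{11})^{s_{11}}, \end{align*} where the sum runs over nonnegative integers $s_{00},s_{10},s_{01},s_{11}$, the binomial symbol is the multinomial coefficient, and $x^0=1$ for all $x$ (including $0^0=1$).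
   Context: A $k$-by-$n$ Latin rectangle on $\{1,\dots,n\}$ is a $k\times n$ matrix with entries in $\{1,\dots,n\}$ such that no row and no column contains a repeated entry. It is reduced if its first row is $1,2,\dots,n$ in order. -}

module Defs where

open import Data.Nat as ℕ using (ℕ; zero; suc; _∸_; _≤_; _!)
open import Data.Nat.Properties using (m*n≢0; _!≢0)

open import Data.Integer as ℤ using (ℤ; +_; -_)
open import Data.Fin using (Fin; zero; suc)
open import Data.Fin.Properties as FinP using (all?)
open import Data.Vec using (Vec; []; _∷_; lookup)
open import Data.Vec.Properties using (≡-dec)
open import Data.List as L using (List; []; _∷_; concatMap; map; filter; length; upTo; allFin)
open import Data.Product using (_×_; _,_)
open import Relation.Binary.PropositionalEquality using (_≡_; _≢_)
open import Relation.Nullary using (Dec; ¬_; _×-dec_; _→-dec_; ¬?)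

-- Latin rectangles: a k×n matrix with entries in Fin n (i.e. {1..n},
-- shifted to {0..n-1}), stored as k rows, each a Vec of length n.

Matrix : ℕ → ℕ → Set
Matrix k n = Vec (Vec (Fin n) n) k

entry : ∀ {k n} → Matrix k n → Fin k → Fin n → Fin n
entry M i j = lookup (lookup M i) j

RowsDistinct : ∀ {k n} → Matrix k n → Set
RowsDistinct {k} {n} M = ∀ (i : Fin k) (j j′ : Fin n) → j ≢ j′ → entry M i j ≢ entry M i j′

ColsDistinct : ∀ {k n} → Matrix k n → Set
ColsDistinct {k} {n} M = ∀ (j : Fin n) (i i′ : Fin k) → i ≢ i′ → entry M i j ≢ entry M i′ j

IsLatinRectangle : ∀ {k n} → Matrix k n → Set
IsLatinRectangle M = RowsDistinct M × ColsDistinct M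

IsReduced : ∀ {k n} → Matrix (suc k) n → Set
IsReduced {k} {n} M = lookup M zero ≡ Data.Vec.allFin n

IsReducedLatin : ∀ {k n} → Matrix (suc k) n → Set
IsReducedLatin M = IsLatinRectangle M × IsReduced M

private
  _≟F_ = FinP._≟_

  dec≢ : ∀ {n} (a b : Fin n) → Dec (a ≢ b)
  dec≢ a b = ¬? (a ≟F b)

isReducedLatin? : ∀ {k n} (M : Matrix (suc k) n) → Dec (IsReducedLatin M)
isReducedLatin? M =
  (all? (λ i → all? (λ j → all? (λ j′ → dec≢ j j′ →-dec dec≢ (entry M i j) (entry M i j′))))
   ×-dec all? (λ j → all? (λ i → all? (λ i′ → dec≢ i i′ →-dec dec≢ (entry M i j) (entry M i′ j)))))
  ×-dec ≡-dec _≟F_ (lookup M zero) (Data.Vec.allFin _)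

allVecs : ∀ n m → List (Vec (Fin n) m)
allVecs n zero = [] ∷ []
allVecs n (suc m) = concatMap (λ x → map (x ∷_) (allVecs n m)) (allFin n)

allMatrices : ∀ k n → List (Matrix k n)
allMatrices zero n = [] ∷ []
allMatrices (suc k) n = concatMap (λ r → map (r ∷_) (allMatrices k n)) (allVecs n n)

-- number of reduced k-by-n Latin rectangles (k ≥ 1 written as suc k)
reducedLatinCount : ℕ → ℕ → ℕ
reducedLatinCount k n = length (filter isReducedLatin? (allMatrices (suc k) n))

R₃ : ℕ → ℕ
R₃ n = reducedLatinCount 2 n

multinomial4 : ℕ → ℕ → ℕ → ℕ → ℕ → ℕ
multinomial4 n a b c d =
  ℕ._/_ (n !) (a ! ℕ.* b ! ℕ.* c ! ℕ.* d !)
    {{m*n≢0 _ _ {{m*n≢0 _ _ {{m*n≢0 _ _ {{a !≢0}} {{b !≢0}}}} {{c !≢0}}}} {{d !≢0}}}}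

g : ℤ → ℤ → ℤ → ℤ → ℤ
g t00 t10 t01 t11 = (t00 ℤ.+ t10) ℤ.* (t00 ℤ.+ t01) ℤ.- t00

compositions4 : ℕ → List (ℕ × ℕ × ℕ × ℕ)
compositions4 n =
  concatMap (λ a → concatMap (λ b → map (λ c → (a , b , c , n ∸ a ∸ b ∸ c))
      (upTo (suc (n ∸ a ∸ b)))) (upTo (suc (n ∸ a)))) (upTo (suc n))

term : ℕ → ℕ × ℕ × ℕ × ℕ → ℤ
term n (s00 , s10 , s01 , s11) =
  ((- ℤ.1ℤ) ℤ.^ (s10 ℕ.+ s01 ℕ.+ 2 ℕ.* s11))
  ℤ.* (+ multinomial4 n s00 s10 s01 s11)
  ℤ.* (g (+ s00 ℤ.- ℤ.1ℤ) (+ s10) (+ s01) (+ s11 ℤ.+ ℤ.1ℤ) ℤ.^ s00)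
  ℤ.* (g (+ s00) (+ s10 ℤ.- ℤ.1ℤ) (+ s01) (+ s11 ℤ.+ ℤ.1ℤ) ℤ.^ s10)
  ℤ.* (g (+ s00) (+ s10) (+ s01 ℤ.- ℤ.1ℤ) (+ s11 ℤ.+ ℤ.1ℤ) ℤ.^ s01)
  ℤ.* (g (+ s00) (+ s10) (+ s01) (+ s11) ℤ.^ s11)

formula : ℕ → ℤ
formula n = L.foldr ℤ._+_ ℤ.0ℤ (map (term n) (compositions4 n))

{-# OPTIONS --safe #-}
-- A reduced 3 × n Latin rectangle is a pair of permutations r₁, r₂ of {1, …, n} such that j, r₁ j
-- and r₂ j are pairwise distinct in every column j.  Inclusion–exclusion detects surjectivity as
-- [r is onto] = Σ_T (−1)^(n − |T|) [r maps into T], once with subsets T for r₁ and once with S for r₂.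
-- For fixed T and S the sum over all matrices factors over the columns, and column j contributes the
-- number of pairs (b, c) ∈ (T ∖ {j}) × (S ∖ {j}) with b ≠ c, which is
-- (|T| − [j ∈ T]) (|S| − [j ∈ S]) − (|T ∩ S| − [j ∈ T ∩ S]).  Together with its sign this depends only
-- on the kind ([j ∉ T], [j ∉ S]) of j and on the numbers s₀₀, s₁₀, s₀₁, s₁₁ of indices of each kind,
-- where it equals ± g(…) of the formula.  Grouping the pairs (T, S) by these numbers, of which there
-- are multinomially many, gives the formula.

module Submission where

open import Defs
open import Data.Nat using (ℕ; _≤_)
open import Data.Integer using (+_)
open import Relation.Binary.PropositionalEquality using (_≡_)

open import Data.Bool.Base using (true; false; if_then_else_)
open import Data.Empty using (⊥-elim)
open import Data.Fin as Fin using (Fin; zero; suc; toℕ; fromℕ<)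
import Data.Fin.Properties as Fin
open import Data.Fin.Subset using (Subset; Side; inside; outside)
open import Data.Integer using (ℤ; -_; _+_; _*_; _-_; 0ℤ; 1ℤ; -1ℤ; _^_)
import Data.Integer.Properties as ℤP
open import Data.Integer.Tactic.RingSolver using (solve-∀)
open import Data.List as List using (List; []; _∷_; _++_; map; foldr; concatMap; filter; applyUpTo; upTo; tabulate; allFin)
open import Data.List.Membership.Propositional using (_∈_)
open import Data.List.Membership.Propositional.Properties using (∈-upTo⁻)
open import Data.List.Relation.Unary.Any using (here; there)
open import Data.Maybe using (Maybe; just; nothing; maybe)
open import Data.Maybe.Properties using (just-injective)
open import Data.Nat as ℕ using (zero; suc; _∸_; _!)
import Data.Nat.DivMod as ℕ
import Data.Nat.Properties as ℕP
import Data.Nat.Tactic.RingSolver as ℕ-Solver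
open import Data.Product using (_×_; _,_; proj₁; proj₂)
open import Data.Product.Properties using (≡-dec)
open import Data.Sum using (_⊎_; inj₁; inj₂)
open import Data.Vec as Vec using (Vec; []; _∷_; lookup)
open import Data.Vec.Properties using (lookup-allFin; tabulate∘lookup; tabulate-cong)
open import Function using (_∘_; _⇔_; mk⇔; Equivalence)
open import Function.Definitions using (Injective; StrictlySurjective)
import Function.Properties.Equivalence as ⇔
open import Relation.Binary.Definitions using (DecidableEquality)
open import Relation.Binary.PropositionalEquality using (_≢_; refl; sym; trans; cong; cong₂; subst; module ≡-Reasoning)
open import Relation.Nullary using (Dec; yes; no; does; ¬_; ¬?; contradiction)
open import Relation.Nullary.Decidable using (decidable-stable)

open import Algebra.Properties.CommutativeMonoid.Sum ℤP.*-1-commutativeMonoid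
  using () renaming (sum to ∏; ∑-distrib-+ to ∏-distrib-*; sum-cong-≗ to ∏-cong)
open import Algebra.Properties.Ring ℤP.+-*-ring using (x[y-z]≈xy-xz)
open import Algebra.Properties.Semiring.Sum ℤP.+-*-semiring
  using (sum; sum-syntax; ∑-distrib-+; *-distribˡ-sum; *-distribʳ-sum; sum-cong-≗; sum-replicate-zero)

private variable
  A B : Set
  m n : ℕ

∏-syntax : ∀ n → (Fin n → ℤ) → ℤ
∏-syntax _ = ∏

infixl 10 ∏-syntax ∑ₗ

syntax ∏-syntax n (λ j → e) = ∏[ j < n ] e

∑ₗ : List A → (A → ℤ) → ℤ
∑ₗ xs f = foldr _+_ 0ℤ (map f xs)

syntax ∑ₗ xs (λ x → e) = ∑[ x ∈ xs ] e

∑ₗ-cong : ∀ (xs : List A) {f g : A → ℤ} → (∀ x → f x ≡ g x) → ∑ₗ xs f ≡ ∑ₗ xs g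
∑ₗ-cong []       f≗g = refl
∑ₗ-cong (x ∷ xs) f≗g = cong₂ _+_ (f≗g x) (∑ₗ-cong xs f≗g)

∑ₗ-cong-∈ : ∀ (xs : List A) {f g : A → ℤ} → (∀ {x} → x ∈ xs → f x ≡ g x) → ∑ₗ xs f ≡ ∑ₗ xs g
∑ₗ-cong-∈ []       f≗g = refl
∑ₗ-cong-∈ (x ∷ xs) f≗g = cong₂ _+_ (f≗g (here refl)) (∑ₗ-cong-∈ xs (f≗g ∘ there))

∑ₗ-++ : ∀ (xs ys : List A) (f : A → ℤ) → ∑ₗ (xs ++ ys) f ≡ ∑ₗ xs f + ∑ₗ ys f
∑ₗ-++ []       ys f = sym (ℤP.+-identityˡ _)
∑ₗ-++ (x ∷ xs) ys f = trans (cong (_+_ (f x)) (∑ₗ-++ xs ys f)) (sym (ℤP.+-assoc (f x) _ _))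

∑ₗ-map : ∀ (g : B → A) (xs : List B) (f : A → ℤ) → ∑ₗ (map g xs) f ≡ ∑ₗ xs (f ∘ g)
∑ₗ-map g []       f = refl
∑ₗ-map g (x ∷ xs) f = cong (_+_ (f (g x))) (∑ₗ-map g xs f)

∑ₗ-concatMap : ∀ (g : B → List A) (xs : List B) (f : A → ℤ) → ∑ₗ (concatMap g xs) f ≡ ∑[ x ∈ xs ] ∑ₗ (g x) f
∑ₗ-concatMap g []       f = refl
∑ₗ-concatMap g (x ∷ xs) f = trans (∑ₗ-++ (g x) (concatMap g xs) f) (cong (_+_ (∑ₗ (g x) f)) (∑ₗ-concatMap g xs f))

∑ₗ-zero : ∀ (xs : List A) → ∑[ x ∈ xs ] 0ℤ ≡ 0ℤ
∑ₗ-zero []       = refl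
∑ₗ-zero (x ∷ xs) = trans (ℤP.+-identityˡ _) (∑ₗ-zero xs)

∑ₗ-distrib-+ : ∀ (xs : List A) (f g : A → ℤ) → ∑[ x ∈ xs ] (f x + g x) ≡ ∑ₗ xs f + ∑ₗ xs g
∑ₗ-distrib-+ []       f g = refl
∑ₗ-distrib-+ (x ∷ xs) f g = trans (cong (_+_ (f x + g x)) (∑ₗ-distrib-+ xs f g)) (interchange (f x) (g x) _ _)
  where interchange : ∀ a b c d → a + b + (c + d) ≡ a + c + (b + d)
        interchange = solve-∀

*-distribˡ-∑ₗ : ∀ c (xs : List A) (f : A → ℤ) → c * ∑ₗ xs f ≡ ∑[ x ∈ xs ] (c * f x)
*-distribˡ-∑ₗ c []       f = ℤP.*-zeroʳ c
*-distribˡ-∑ₗ c (x ∷ xs) f = trans (ℤP.*-distribˡ-+ c (f x) _) (cong (_+_ (c * f x)) (*-distribˡ-∑ₗ c xs f))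

*-distribʳ-∑ₗ : ∀ c (xs : List A) (f : A → ℤ) → ∑ₗ xs f * c ≡ ∑[ x ∈ xs ] (f x * c)
*-distribʳ-∑ₗ c []       f = refl
*-distribʳ-∑ₗ c (x ∷ xs) f = trans (ℤP.*-distribʳ-+ c (f x) _) (cong (_+_ (f x * c)) (*-distribʳ-∑ₗ c xs f))

∑ₗ-comm : ∀ (xs : List A) (ys : List B) (f : A → B → ℤ) → ∑[ x ∈ xs ] ∑[ y ∈ ys ] f x y ≡ ∑[ y ∈ ys ] ∑[ x ∈ xs ] f x y
∑ₗ-comm []       ys f = sym (∑ₗ-zero ys)
∑ₗ-comm (x ∷ xs) ys f = trans (cong (_+_ (∑ₗ ys (f x))) (∑ₗ-comm xs ys f)) (sym (∑ₗ-distrib-+ ys (f x) _))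

∑ₗ-*-∑ₗ : ∀ (xs : List A) (ys : List B) (f : A → ℤ) (g : B → ℤ) → ∑ₗ xs f * ∑ₗ ys g ≡ ∑[ x ∈ xs ] ∑[ y ∈ ys ] (f x * g y)
∑ₗ-*-∑ₗ xs ys f g = trans (*-distribʳ-∑ₗ (∑ₗ ys g) xs f) (∑ₗ-cong xs λ x → *-distribˡ-∑ₗ (f x) ys g)

∑ₗ-tabulate : ∀ (g : Fin n → A) (f : A → ℤ) → ∑[ x ∈ tabulate g ] f x ≡ ∑[ i < n ] f (g i)
∑ₗ-tabulate {n = zero}  g f = refl
∑ₗ-tabulate {n = suc n} g f = cong (_+_ (f (g zero))) (∑ₗ-tabulate (g ∘ suc) f)

∑ₗ-allFin : ∀ (f : Fin n → ℤ) → ∑[ i ∈ allFin n ] f i ≡ ∑[ i < n ] f i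
∑ₗ-allFin = ∑ₗ-tabulate (λ i → i)

∑ₗ-applyUpTo : ∀ (g : ℕ → A) n (f : A → ℤ) → ∑[ x ∈ applyUpTo g n ] f x ≡ ∑[ i < n ] f (g (toℕ i))
∑ₗ-applyUpTo g zero    f = refl
∑ₗ-applyUpTo g (suc n) f = cong (_+_ (f (g 0))) (∑ₗ-applyUpTo (g ∘ suc) n f)

∑-neg : ∀ (f : Fin n → ℤ) → ∑[ i < n ] (- f i) ≡ - ∑[ i < n ] f i
∑-neg {zero}  f = refl
∑-neg {suc n} f = trans (cong (_+_ (- f zero)) (∑-neg (f ∘ suc))) (sym (ℤP.neg-distrib-+ (f zero) _))

∑-distrib-- : ∀ (f g : Fin n → ℤ) → ∑[ i < n ] (f i - g i) ≡ ∑[ i < n ] f i - ∑[ i < n ] g i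
∑-distrib-- f g = trans (∑-distrib-+ f (λ i → - g i)) (cong (_+_ (sum f)) (∑-neg g))

-- Defined through does, so that it computes from the decision alone: 𝟙 (suc i ≟ suc j) is 𝟙 (i ≟ j).
𝟙 : {P : Set} → Dec P → ℤ
𝟙 P? = if does P? then 1ℤ else 0ℤ

data IsIndicator (x : ℤ) (P : Set) : Set where
  holds : P → x ≡ 1ℤ → IsIndicator x P
  fails : ¬ P → x ≡ 0ℤ → IsIndicator x P

𝟙-isIndicator : {P : Set} (P? : Dec P) → IsIndicator (𝟙 P?) P
𝟙-isIndicator (yes p) = holds p refl
𝟙-isIndicator (no ¬p) = fails ¬p refl

isIndicator-unique : ∀ {x y P} → IsIndicator x P → IsIndicator y P → x ≡ y
isIndicator-unique (holds _  x≡1) (holds _  y≡1) = trans x≡1 (sym y≡1)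
isIndicator-unique (holds p  _)   (fails ¬p _)   = ⊥-elim (¬p p)
isIndicator-unique (fails ¬p _)   (holds p  _)   = ⊥-elim (¬p p)
isIndicator-unique (fails _  x≡0) (fails _  y≡0) = trans x≡0 (sym y≡0)

isIndicator-⇔ : ∀ {x P Q} → P ⇔ Q → IsIndicator x P → IsIndicator x Q
isIndicator-⇔ P⇔Q (holds p  x≡1) = holds (Equivalence.to P⇔Q p) x≡1
isIndicator-⇔ P⇔Q (fails ¬p x≡0) = fails (¬p ∘ Equivalence.from P⇔Q) x≡0

isIndicator-* : ∀ {x y P Q} → IsIndicator x P → IsIndicator y Q → IsIndicator (x * y) (P × Q)
isIndicator-* (holds p refl) (holds q refl)  = holds (p , q) refl
isIndicator-* (holds _ refl) (fails ¬q refl) = fails (¬q ∘ proj₂) refl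
isIndicator-* (fails ¬p refl) _              = fails (¬p ∘ proj₁) refl

isIndicator-¬ : ∀ {x P} → IsIndicator x P → IsIndicator (1ℤ - x) (¬ P)
isIndicator-¬ (holds p  refl) = fails (λ ¬p → ¬p p) refl
isIndicator-¬ (fails ¬p refl) = holds ¬p refl

isIndicator-∏ : ∀ {f : Fin n → ℤ} {P : Fin n → Set} → (∀ j → IsIndicator (f j) (P j)) → IsIndicator (∏ f) (∀ j → P j)
isIndicator-∏ {zero}  _  = holds (λ ()) refl
isIndicator-∏ {suc n} fP = isIndicator-⇔ (mk⇔ (λ (p₀ , p) → λ { zero → p₀ ; (suc j) → p j }) (λ p → p zero , p ∘ suc))
                                         (isIndicator-* (fP zero) (isIndicator-∏ (fP ∘ suc)))

𝟙-cong : ∀ {P Q} (P? : Dec P) (Q? : Dec Q) → P ⇔ Q → 𝟙 P? ≡ 𝟙 Q?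
𝟙-cong P? Q? P⇔Q = isIndicator-unique (isIndicator-⇔ P⇔Q (𝟙-isIndicator P?)) (𝟙-isIndicator Q?)

𝟙-no : ∀ {P} (P? : Dec P) → ¬ P → 𝟙 P? ≡ 0ℤ
𝟙-no (yes p) ¬p = contradiction p ¬p
𝟙-no (no _)  _  = refl

𝟙-¬ : ∀ {P} (P? : Dec P) → 𝟙 (¬? P?) ≡ 1ℤ - 𝟙 P?
𝟙-¬ (yes _) = refl
𝟙-¬ (no _)  = refl

𝟙-idem : ∀ {P} (P? : Dec P) → 𝟙 P? * 𝟙 P? ≡ 𝟙 P?
𝟙-idem (yes _) = refl
𝟙-idem (no _)  = refl

length-filter : ∀ {P : A → Set} (P? : ∀ x → Dec (P x)) xs → + List.length (filter P? xs) ≡ ∑[ x ∈ xs ] 𝟙 (P? x)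
length-filter P? []       = refl
length-filter P? (x ∷ xs) with does (P? x)
... | true  = cong (_+_ 1ℤ) (length-filter P? xs)
... | false = trans (length-filter P? xs) (sym (ℤP.+-identityˡ _))

vecs : List A → (m : ℕ) → List (Vec A m)
vecs xs zero    = [] ∷ []
vecs xs (suc m) = concatMap (λ x → map (x ∷_) (vecs xs m)) xs

allVecs≡vecs : ∀ n m → allVecs n m ≡ vecs (allFin n) m
allVecs≡vecs n zero    = refl
allVecs≡vecs n (suc m) = cong (λ vs → concatMap (λ x → map (x ∷_) vs) (allFin n)) (allVecs≡vecs n m)

∑ₗ-cons-pairs : ∀ {k} (xs : List A) (vs : List (Vec A k)) (F : Vec A (suc k) → ℤ) →
           ∑[ v ∈ concatMap (λ x → map (x ∷_) vs) xs ] F v ≡ ∑[ x ∈ xs ] ∑[ v ∈ vs ] F (x ∷ v)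
∑ₗ-cons-pairs xs vs F = trans (∑ₗ-concatMap _ xs F) (∑ₗ-cong xs λ x → ∑ₗ-map (x ∷_) vs F)

∑-vecs-∏ : ∀ (xs : List A) m (φ : Fin m → A → ℤ) →
           ∑[ v ∈ vecs xs m ] ∏[ j < m ] φ j (lookup v j) ≡ ∏[ j < m ] ∑[ x ∈ xs ] φ j x
∑-vecs-∏ xs zero    φ = refl
∑-vecs-∏ xs (suc m) φ = begin
  ∑[ v ∈ vecs xs (suc m) ] ∏[ j < suc m ] φ j (lookup v j)
    ≡⟨ ∑ₗ-cons-pairs xs (vecs xs m) _ ⟩
  ∑[ x ∈ xs ] ∑[ v ∈ vecs xs m ] (φ zero x * ∏[ j < m ] φ (suc j) (lookup v j))
    ≡⟨ ∑ₗ-cong xs (λ x → sym (*-distribˡ-∑ₗ (φ zero x) (vecs xs m) _)) ⟩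
  ∑[ x ∈ xs ] (φ zero x * ∑[ v ∈ vecs xs m ] ∏[ j < m ] φ (suc j) (lookup v j))
    ≡⟨ sym (*-distribʳ-∑ₗ _ xs (φ zero)) ⟩
  ∑ₗ xs (φ zero) * ∑[ v ∈ vecs xs m ] ∏[ j < m ] φ (suc j) (lookup v j)
    ≡⟨ cong (∑ₗ xs (φ zero) *_) (∑-vecs-∏ xs m (φ ∘ suc)) ⟩
  ∑ₗ xs (φ zero) * ∏[ j < m ] ∑[ x ∈ xs ] φ (suc j) x
    ∎
  where open ≡-Reasoning

∑-allVecs-suc : ∀ m (F : Vec (Fin n) (suc m) → ℤ) →
                ∑[ v ∈ allVecs n (suc m) ] F v ≡ ∑[ a < n ] ∑[ v ∈ allVecs n m ] F (a ∷ v)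
∑-allVecs-suc {n} m F = trans (∑ₗ-cons-pairs (allFin n) (allVecs n m) F) (∑ₗ-allFin (λ a → ∑[ v ∈ allVecs n m ] F (a ∷ v)))

∑-allVecs-∏ : ∀ m (φ : Fin m → Fin n → ℤ) →
              ∑[ r ∈ allVecs n m ] ∏[ j < m ] φ j (lookup r j) ≡ ∏[ j < m ] ∑[ a < n ] φ j a
∑-allVecs-∏ {n} m φ = begin
  ∑[ r ∈ allVecs n m ] ∏[ j < m ] φ j (lookup r j)
    ≡⟨ cong (λ rs → ∑[ r ∈ rs ] ∏[ j < m ] φ j (lookup r j)) (allVecs≡vecs n m) ⟩
  ∑[ r ∈ vecs (allFin n) m ] ∏[ j < m ] φ j (lookup r j)
    ≡⟨ ∑-vecs-∏ (allFin n) m φ ⟩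
  ∏[ j < m ] ∑[ a ∈ allFin n ] φ j a
    ≡⟨ ∏-cong (λ j → ∑ₗ-allFin (φ j)) ⟩
  ∏[ j < m ] ∑[ a < n ] φ j a
    ∎
  where open ≡-Reasoning

column : ∀ {k} → Fin n → Matrix k n → Vec (Fin n) k
column j M = Vec.map (λ r → lookup r j) M

∑-matrices-∏ : ∀ k (Ψ : Fin n → Vec (Fin n) k → ℤ) →
               ∑[ M ∈ allMatrices k n ] ∏[ j < n ] Ψ j (column j M) ≡ ∏[ j < n ] ∑[ c ∈ allVecs n k ] Ψ j c
∑-matrices-∏ {n} zero    Ψ = trans (ℤP.+-identityʳ _) (∏-cong λ j → sym (ℤP.+-identityʳ (Ψ j [])))
∑-matrices-∏ {n} (suc k) Ψ = begin
  ∑[ M ∈ allMatrices (suc k) n ] ∏[ j < n ] Ψ j (column j M)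
    ≡⟨ ∑ₗ-cons-pairs (allVecs n n) (allMatrices k n) _ ⟩
  ∑[ r ∈ allVecs n n ] ∑[ M ∈ allMatrices k n ] ∏[ j < n ] Ψ j (lookup r j ∷ column j M)
    ≡⟨ ∑ₗ-cong (allVecs n n) (λ r → ∑-matrices-∏ k (λ j c → Ψ j (lookup r j ∷ c))) ⟩
  ∑[ r ∈ allVecs n n ] ∏[ j < n ] ∑[ c ∈ allVecs n k ] Ψ j (lookup r j ∷ c)
    ≡⟨ ∑-allVecs-∏ n (λ j a → ∑[ c ∈ allVecs n k ] Ψ j (a ∷ c)) ⟩
  ∏[ j < n ] ∑[ a < n ] ∑[ c ∈ allVecs n k ] Ψ j (a ∷ c)
    ≡⟨ ∏-cong (λ j → sym (∑-allVecs-suc k (Ψ j))) ⟩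
  ∏[ j < n ] ∑[ c ∈ allVecs n (suc k) ] Ψ j c
    ∎
  where open ≡-Reasoning

∑-allVecs-3 : ∀ (F : Vec (Fin n) 3 → ℤ) →
              ∑[ c ∈ allVecs n 3 ] F c ≡ ∑[ a < n ] ∑[ b < n ] ∑[ c < n ] F (a ∷ b ∷ c ∷ [])
∑-allVecs-3 {n} F =
  trans (∑-allVecs-suc 2 F) (sum-cong-≗ λ a →
  trans (∑-allVecs-suc 1 (λ v → F (a ∷ v))) (sum-cong-≗ λ b →
  trans (∑-allVecs-suc 0 (λ v → F (a ∷ b ∷ v))) (sum-cong-≗ λ c → ℤP.+-identityʳ (F (a ∷ b ∷ c ∷ [])))))

∑-δ : ∀ (j : Fin n) (f : Fin n → ℤ) → ∑[ i < n ] (𝟙 (i Fin.≟ j) * f i) ≡ f j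
∑-δ {suc n} zero    f = trans (cong₂ _+_ (ℤP.*-identityˡ (f zero)) (sum-replicate-zero n)) (ℤP.+-identityʳ (f zero))
∑-δ {suc n} (suc j) f = trans (ℤP.+-identityˡ _) (∑-δ j (f ∘ suc))

∑-omit : ∀ (j : Fin n) (f : Fin n → ℤ) → ∑[ i < n ] (f i * 𝟙 (¬? (i Fin.≟ j))) ≡ sum f - f j
∑-omit {n} j f = begin
  ∑[ i < n ] (f i * 𝟙 (¬? (i Fin.≟ j)))
    ≡⟨ sum-cong-≗ (λ i → trans (cong (f i *_) (𝟙-¬ (i Fin.≟ j))) (expand (f i) (𝟙 (i Fin.≟ j)))) ⟩
  ∑[ i < n ] (f i - 𝟙 (i Fin.≟ j) * f i)
    ≡⟨ ∑-distrib-- f (λ i → 𝟙 (i Fin.≟ j) * f i) ⟩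
  sum f - ∑[ i < n ] (𝟙 (i Fin.≟ j) * f i)
    ≡⟨ cong (_-_ (sum f)) (∑-δ j f) ⟩
  sum f - f j
    ∎
  where
  open ≡-Reasoning
  expand : ∀ x d → x * (1ℤ - d) ≡ x - d * x
  expand = solve-∀

∑-offDiagonal : ∀ (u v : Fin n → ℤ) →
                ∑[ b < n ] ∑[ c < n ] (u b * v c * 𝟙 (¬? (c Fin.≟ b))) ≡ sum u * sum v - ∑[ b < n ] (u b * v b)
∑-offDiagonal {n} u v = begin
  ∑[ b < n ] ∑[ c < n ] (u b * v c * 𝟙 (¬? (c Fin.≟ b)))
    ≡⟨ sum-cong-≗ (λ b → trans (sum-cong-≗ λ c → ℤP.*-assoc (u b) (v c) _) (sym (*-distribˡ-sum (u b) (λ c → v c * 𝟙 (¬? (c Fin.≟ b)))))) ⟩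
  ∑[ b < n ] (u b * ∑[ c < n ] (v c * 𝟙 (¬? (c Fin.≟ b))))
    ≡⟨ sum-cong-≗ (λ b → trans (cong (u b *_) (∑-omit b v)) (x[y-z]≈xy-xz (u b) (sum v) (v b))) ⟩
  ∑[ b < n ] (u b * sum v - u b * v b)
    ≡⟨ ∑-distrib-- (λ b → u b * sum v) (λ b → u b * v b) ⟩
  ∑[ b < n ] (u b * sum v) - ∑[ b < n ] (u b * v b)
    ≡⟨ cong (_- ∑[ b < n ] (u b * v b)) (sym (*-distribʳ-sum (sum v) u)) ⟩
  sum u * sum v - ∑[ b < n ] (u b * v b)
    ∎
  where open ≡-Reasoning

LatinColumn : Fin n → Fin n → Fin n → Fin n → Set
LatinColumn j a b c = a ≡ j × b ≢ a × c ≢ a × c ≢ b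

latinColumn : Fin n → Fin n → Fin n → Fin n → ℤ
latinColumn j a b c = 𝟙 (a Fin.≟ j) * (𝟙 (¬? (b Fin.≟ a)) * (𝟙 (¬? (c Fin.≟ a)) * 𝟙 (¬? (c Fin.≟ b))))

latinColumn-isIndicator : ∀ (j a b c : Fin n) → IsIndicator (latinColumn j a b c) (LatinColumn j a b c)
latinColumn-isIndicator j a b c =
  isIndicator-* (𝟙-isIndicator (a Fin.≟ j))
    (isIndicator-* (𝟙-isIndicator (¬? (b Fin.≟ a))) (isIndicator-* (𝟙-isIndicator (¬? (c Fin.≟ a))) (𝟙-isIndicator (¬? (c Fin.≟ b)))))

avoidingPairs : ℤ → ℤ → ℤ → ℤ → ℤ → ℤ
avoidingPairs sizeT sizeS sizeT∩S tⱼ sⱼ = (sizeT - tⱼ) * (sizeS - sⱼ) - (sizeT∩S - tⱼ * sⱼ)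

columnValue : (t s : Fin n → ℤ) → Fin n → ℤ
columnValue {n} t s j = avoidingPairs (sum t) (sum s) (∑[ b < n ] (t b * s b)) (t j) (s j)

∑-latinColumn : ∀ (t s : Fin n → ℤ) j →
                ∑[ a < n ] ∑[ b < n ] ∑[ c < n ] (t b * (s c * latinColumn j a b c)) ≡ columnValue t s j
∑-latinColumn {n} t s j = begin
  ∑[ a < n ] ∑[ b < n ] ∑[ c < n ] (t b * (s c * latinColumn j a b c))
    ≡⟨ sum-cong-≗ pull-a ⟩
  ∑[ a < n ] (𝟙 (a Fin.≟ j) * ∑[ b < n ] ∑[ c < n ] (t b * (s c * distinct a b c)))
    ≡⟨ ∑-δ j _ ⟩
  ∑[ b < n ] ∑[ c < n ] (t b * (s c * distinct j b c))
    ≡⟨ sum-cong-≗ (λ b → sum-cong-≗ λ c → regroup (t b) (s c) (off j b) (off j c) (off b c)) ⟩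
  ∑[ b < n ] ∑[ c < n ] (u b * v c * off b c)
    ≡⟨ ∑-offDiagonal u v ⟩
  sum u * sum v - ∑[ b < n ] (u b * v b)
    ≡⟨ cong₂ (λ x y → x * y - ∑[ b < n ] (u b * v b)) (∑-omit j t) (∑-omit j s) ⟩
  (sum t - t j) * (sum s - s j) - ∑[ b < n ] (u b * v b)
    ≡⟨ cong (_-_ ((sum t - t j) * (sum s - s j))) (trans (sum-cong-≗ diagonal) (∑-omit j (λ b → t b * s b))) ⟩
  columnValue t s j
    ∎
  where
  open ≡-Reasoning
  off : Fin n → Fin n → ℤ
  off b c = 𝟙 (¬? (c Fin.≟ b))
  distinct : Fin n → Fin n → Fin n → ℤ
  distinct a b c = off a b * (off a c * off b c)
  u v : Fin n → ℤ
  u b = t b * off j b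
  v c = s c * off j c
  pull-a : ∀ a → ∑[ b < n ] ∑[ c < n ] (t b * (s c * latinColumn j a b c))
                 ≡ 𝟙 (a Fin.≟ j) * ∑[ b < n ] ∑[ c < n ] (t b * (s c * distinct a b c))
  pull-a a = trans (sum-cong-≗ λ b → trans (sum-cong-≗ λ c → pull (t b) (s c) (𝟙 (a Fin.≟ j)) (distinct a b c))
                                           (sym (*-distribˡ-sum (𝟙 (a Fin.≟ j)) (λ c → t b * (s c * distinct a b c)))))
                   (sym (*-distribˡ-sum (𝟙 (a Fin.≟ j)) (λ b → ∑[ c < n ] (t b * (s c * distinct a b c)))))
    where pull : ∀ x y d r → x * (y * (d * r)) ≡ d * (x * (y * r))
          pull = solve-∀
  regroup : ∀ x y p q r → x * (y * (p * (q * r))) ≡ x * p * (y * q) * r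
  regroup = solve-∀
  diagonal : ∀ b → u b * v b ≡ t b * s b * off j b
  diagonal b = trans (square (t b) (s b) (off j b)) (cong (t b * s b *_) (𝟙-idem (¬? (b Fin.≟ j))))
    where square : ∀ x y p → x * p * (y * p) ≡ x * y * (p * p)
          square = solve-∀

-- Reduced Latin rectangles

injective⇒surjective : ∀ {f : Fin n → Fin n} → Injective _≡_ _≡_ f → StrictlySurjective _≡_ f
injective⇒surjective {suc n} {f} f-inj k with Fin.any? (λ j → f j Fin.≟ k)
... | yes hit  = hit
... | no  miss = contradiction (Fin.injective⇒≤ f-avoiding-k-inj) (ℕP.<-irrefl refl)
  where
  k≢f : ∀ j → k ≢ f j
  k≢f j k≡fj = miss (j , sym k≡fj)
  f-avoiding-k : Fin (suc n) → Fin n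
  f-avoiding-k j = Fin.punchOut (k≢f j)
  f-avoiding-k-inj : Injective _≡_ _≡_ f-avoiding-k
  f-avoiding-k-inj = f-inj ∘ Fin.punchOut-injective (k≢f _) (k≢f _)

-- A section h of f is injective, hence onto; so i = h a, j = h b, and a = f i = f j = b.
surjective⇒injective : ∀ {f : Fin n → Fin n} → StrictlySurjective _≡_ f → Injective _≡_ _≡_ f
surjective⇒injective {f = f} f-surj {i} {j} fi≡fj = begin
  i      ≡⟨ sym (proj₂ (h-surj i)) ⟩
  h a    ≡⟨ cong h a≡b ⟩
  h b    ≡⟨ proj₂ (h-surj j) ⟩
  j      ∎
  where
  open ≡-Reasoning
  h = λ k → proj₁ (f-surj k)
  f∘h : ∀ k → f (h k) ≡ k
  f∘h k = proj₂ (f-surj k)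
  h-surj : StrictlySurjective _≡_ h
  h-surj = injective⇒surjective λ {x} {y} hx≡hy → trans (sym (f∘h x)) (trans (cong f hx≡hy) (f∘h y))
  a = proj₁ (h-surj i)
  b = proj₁ (h-surj j)
  a≡b : a ≡ b
  a≡b = begin
    a          ≡⟨ sym (f∘h a) ⟩
    f (h a)    ≡⟨ cong f (proj₂ (h-surj i)) ⟩
    f i        ≡⟨ fi≡fj ⟩
    f j        ≡⟨ cong f (sym (proj₂ (h-surj j))) ⟩
    f (h b)    ≡⟨ f∘h b ⟩
    b          ∎

distinct⇒injective : ∀ {f : Fin m → Fin n} → (∀ i j → i ≢ j → f i ≢ f j) → Injective _≡_ _≡_ f
distinct⇒injective distinct {i} {j} fi≡fj = decidable-stable (i Fin.≟ j) (λ i≢j → distinct i j i≢j fi≡fj)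

reducedLatin⇔ : ∀ (r₀ r₁ r₂ : Vec (Fin n) n) →
                IsReducedLatin (r₀ ∷ r₁ ∷ r₂ ∷ []) ⇔
                (StrictlySurjective _≡_ (lookup r₁) × StrictlySurjective _≡_ (lookup r₂) ×
                 ∀ j → LatinColumn j (lookup r₀ j) (lookup r₁ j) (lookup r₂ j))
reducedLatin⇔ {n} r₀ r₁ r₂ = mk⇔ to from
  where
  M = r₀ ∷ r₁ ∷ r₂ ∷ []
  to : IsReducedLatin M → _
  to ((rows , cols) , reduced) =
    injective⇒surjective (distinct⇒injective (rows (suc zero))) ,
    injective⇒surjective (distinct⇒injective (rows (suc (suc zero)))) ,
    λ j → trans (cong (λ r → lookup r j) reduced) (lookup-allFin j) ,
          cols j (suc zero) zero (λ ()) , cols j (suc (suc zero)) zero (λ ()) , cols j (suc (suc zero)) (suc zero) (λ ())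
  from : _ → IsReducedLatin M
  from (r₁-surj , r₂-surj , latin) = (rows , cols) , reduced
    where
    r₀-id : ∀ j → lookup r₀ j ≡ j
    r₀-id j = proj₁ (latin j)
    reduced : IsReduced M
    reduced = trans (sym (tabulate∘lookup r₀)) (tabulate-cong r₀-id)
    rows : RowsDistinct M
    rows zero             j j′ j≢j′ e = j≢j′ (trans (sym (r₀-id j)) (trans e (r₀-id j′)))
    rows (suc zero)       j j′ j≢j′ e = j≢j′ (surjective⇒injective r₁-surj e)
    rows (suc (suc zero)) j j′ j≢j′ e = j≢j′ (surjective⇒injective r₂-surj e)
    cols : ColsDistinct M
    cols j zero             zero             ne = contradiction refl ne
    cols j zero             (suc zero)       _  = proj₁ (proj₂ (latin j)) ∘ sym
    cols j zero             (suc (suc zero)) _  = proj₁ (proj₂ (proj₂ (latin j))) ∘ sym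
    cols j (suc zero)       zero             _  = proj₁ (proj₂ (latin j))
    cols j (suc zero)       (suc zero)       ne = contradiction refl ne
    cols j (suc zero)       (suc (suc zero)) _  = proj₂ (proj₂ (proj₂ (latin j))) ∘ sym
    cols j (suc (suc zero)) zero             _  = proj₁ (proj₂ (proj₂ (latin j)))
    cols j (suc (suc zero)) (suc zero)       _  = proj₂ (proj₂ (proj₂ (latin j)))
    cols j (suc (suc zero)) (suc (suc zero)) ne = contradiction refl ne

-- Inclusion–exclusion

sides : List Side
sides = inside ∷ outside ∷ []

subsets : ∀ n → List (Subset n)
subsets = vecs sides

fromSide : Side → ℤ
fromSide inside  = 1ℤ
fromSide outside = 0ℤ

sideSign : Side → ℤ
sideSign inside  = 1ℤ
sideSign outside = -1ℤ

χ : Subset n → Fin n → ℤ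
χ T b = fromSide (lookup T b)

sign : Subset n → ℤ
sign {n} T = ∏[ k < n ] sideSign (lookup T k)

fromSide-isIndicator : ∀ x → IsIndicator (fromSide x) (x ≡ inside)
fromSide-isIndicator inside  = holds refl refl
fromSide-isIndicator outside = fails (λ ()) refl

ontoIndicator : (Fin m → Fin n) → ℤ
ontoIndicator {m} {n} ρ = ∑[ T ∈ subsets n ] (sign T * ∏[ j < m ] χ T (ρ j))

module _ (ρ : Fin m → Fin n) where

  missed : Fin n → ℤ
  missed k = ∏[ j < m ] 𝟙 (¬? (ρ j Fin.≟ k))

  missed-isIndicator : ∀ k → IsIndicator (missed k) (∀ j → ρ j ≢ k)
  missed-isIndicator k = isIndicator-∏ λ j → 𝟙-isIndicator (¬? (ρ j Fin.≟ k))

  coverWeight : Fin n → Side → ℤ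
  coverWeight k inside  = 1ℤ
  coverWeight k outside = missed k

  coverWeight-isIndicator : ∀ k x → IsIndicator (coverWeight k x) (x ≡ inside ⊎ ∀ j → ρ j ≢ k)
  coverWeight-isIndicator k inside  = holds (inj₁ refl) refl
  coverWeight-isIndicator k outside =
    isIndicator-⇔ (mk⇔ inj₂ λ { (inj₁ ()) ; (inj₂ miss) → miss }) (missed-isIndicator k)

  ∏χ≡∏coverWeight : ∀ T → ∏[ j < m ] χ T (ρ j) ≡ ∏[ k < n ] coverWeight k (lookup T k)
  ∏χ≡∏coverWeight T = isIndicator-unique
    (isIndicator-∏ λ j → fromSide-isIndicator (lookup T (ρ j)))
    (isIndicator-⇔ (mk⇔ from to) (isIndicator-∏ λ k → coverWeight-isIndicator k (lookup T k)))
    where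
    to : (∀ j → lookup T (ρ j) ≡ inside) → ∀ k → lookup T k ≡ inside ⊎ ∀ j → ρ j ≢ k
    to image⊆T k with lookup T k in eq
    ... | inside  = inj₁ refl
    ... | outside = inj₂ λ j ρj≡k → outside≢inside (trans (sym eq) (trans (cong (lookup T) (sym ρj≡k)) (image⊆T j)))
      where outside≢inside : outside ≢ inside
            outside≢inside ()
    from : (∀ k → lookup T k ≡ inside ⊎ ∀ j → ρ j ≢ k) → ∀ j → lookup T (ρ j) ≡ inside
    from covered j with covered (ρ j)
    ... | inj₁ ρj∈T = ρj∈T
    ... | inj₂ miss = contradiction refl (miss j)

  ontoIndicator≡∏ : ontoIndicator ρ ≡ ∏[ k < n ] (1ℤ - missed k)
  ontoIndicator≡∏ = begin
    ∑[ T ∈ subsets n ] (sign T * ∏[ j < m ] χ T (ρ j))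
      ≡⟨ ∑ₗ-cong (subsets n) (λ T → trans (cong (sign T *_) (∏χ≡∏coverWeight T))
                                         (sym (∏-distrib-* (sideSign ∘ lookup T) (λ k → coverWeight k (lookup T k))))) ⟩
    ∑[ T ∈ subsets n ] ∏[ k < n ] (sideSign (lookup T k) * coverWeight k (lookup T k))
      ≡⟨ ∑-vecs-∏ sides n (λ k x → sideSign x * coverWeight k x) ⟩
    ∏[ k < n ] (1ℤ * 1ℤ + (-1ℤ * missed k + 0ℤ))
      ≡⟨ ∏-cong (λ k → simplify (missed k)) ⟩
    ∏[ k < n ] (1ℤ - missed k)
      ∎
    where
    open ≡-Reasoning
    simplify : ∀ z → 1ℤ * 1ℤ + (-1ℤ * z + 0ℤ) ≡ 1ℤ - z
    simplify = solve-∀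

  ontoIndicator-isIndicator : IsIndicator (ontoIndicator ρ) (StrictlySurjective _≡_ ρ)
  ontoIndicator-isIndicator =
    subst (λ x → IsIndicator x (StrictlySurjective _≡_ ρ)) (sym ontoIndicator≡∏)
      (isIndicator-⇔ (mk⇔ to from) (isIndicator-∏ λ k → isIndicator-¬ (missed-isIndicator k)))
    where
    to : (∀ k → ¬ (∀ j → ρ j ≢ k)) → StrictlySurjective _≡_ ρ
    to hit k with Fin.any? (λ j → ρ j Fin.≟ k)
    ... | yes found = found
    ... | no  none  = contradiction (λ j ρj≡k → none (j , ρj≡k)) (hit k)
    from : StrictlySurjective _≡_ ρ → ∀ k → ¬ (∀ j → ρ j ≢ k)
    from ρ-surj k miss = miss (proj₁ (ρ-surj k)) (proj₂ (ρ-surj k))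

ontoIndicator-*-ontoIndicator : ∀ (ρ σ : Fin m → Fin n) (w : Fin m → ℤ) →
  ontoIndicator ρ * (ontoIndicator σ * ∏ w) ≡
  ∑[ T ∈ subsets n ] ∑[ S ∈ subsets n ] (sign T * sign S * ∏[ j < m ] (χ T (ρ j) * (χ S (σ j) * w j)))
ontoIndicator-*-ontoIndicator {m} {n} ρ σ w = begin
  ontoIndicator ρ * (ontoIndicator σ * ∏ w)
    ≡⟨ cong (ontoIndicator ρ *_) (*-distribʳ-∑ₗ (∏ w) (subsets n) (λ S → sign S * ∏ (χσ S))) ⟩
  ontoIndicator ρ * ∑[ S ∈ subsets n ] (sign S * ∏ (χσ S) * ∏ w)
    ≡⟨ ∑ₗ-*-∑ₗ (subsets n) (subsets n) (λ T → sign T * ∏ (χρ T)) (λ S → sign S * ∏ (χσ S) * ∏ w) ⟩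
  ∑[ T ∈ subsets n ] ∑[ S ∈ subsets n ] (sign T * ∏ (χρ T) * (sign S * ∏ (χσ S) * ∏ w))
    ≡⟨ ∑ₗ-cong (subsets n) (λ T → ∑ₗ-cong (subsets n) λ S → regroup T S) ⟩
  ∑[ T ∈ subsets n ] ∑[ S ∈ subsets n ] (sign T * sign S * ∏[ j < m ] (χρ T j * (χσ S j * w j)))
    ∎
  where
  open ≡-Reasoning
  χρ χσ : Subset n → Fin m → ℤ
  χρ T j = χ T (ρ j)
  χσ S j = χ S (σ j)
  regroup : ∀ T S → sign T * ∏ (χρ T) * (sign S * ∏ (χσ S) * ∏ w) ≡ sign T * sign S * ∏[ j < m ] (χρ T j * (χσ S j * w j))
  regroup T S = begin
    sign T * ∏ (χρ T) * (sign S * ∏ (χσ S) * ∏ w)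
      ≡⟨ reorder (sign T) (∏ (χρ T)) (sign S) (∏ (χσ S)) (∏ w) ⟩
    sign T * sign S * (∏ (χρ T) * (∏ (χσ S) * ∏ w))
      ≡⟨ cong (λ x → sign T * sign S * (∏ (χρ T) * x)) (sym (∏-distrib-* (χσ S) w)) ⟩
    sign T * sign S * (∏ (χρ T) * ∏[ j < m ] (χσ S j * w j))
      ≡⟨ cong (sign T * sign S *_) (sym (∏-distrib-* (χρ T) (λ j → χσ S j * w j))) ⟩
    sign T * sign S * ∏[ j < m ] (χρ T j * (χσ S j * w j))
      ∎
    where reorder : ∀ t p s q w → t * p * (s * q * w) ≡ t * s * (p * (q * w))
          reorder = solve-∀

columnTerm : Subset n → Subset n → Fin n → Vec (Fin n) 3 → ℤ
columnTerm T S j (a ∷ b ∷ c ∷ []) = χ T b * (χ S c * latinColumn j a b c)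

signedColumns : Subset n → Subset n → Matrix 3 n → ℤ
signedColumns {n} T S M = sign T * sign S * ∏[ j < n ] columnTerm T S j (column j M)

𝟙-reducedLatin : ∀ (M : Matrix 3 n) →
                 𝟙 (isReducedLatin? M) ≡ ∑[ T ∈ subsets n ] ∑[ S ∈ subsets n ] signedColumns T S M
𝟙-reducedLatin {n} M@(r₀ ∷ r₁ ∷ r₂ ∷ []) = begin
  𝟙 (isReducedLatin? M)
    ≡⟨ isIndicator-unique (𝟙-isIndicator (isReducedLatin? M)) (isIndicator-⇔ (⇔.sym (reducedLatin⇔ r₀ r₁ r₂))
         (isIndicator-* (ontoIndicator-isIndicator ρ₁) (isIndicator-* (ontoIndicator-isIndicator ρ₂)
           (isIndicator-∏ λ j → latinColumn-isIndicator j (ρ₀ j) (ρ₁ j) (ρ₂ j))))) ⟩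
  ontoIndicator ρ₁ * (ontoIndicator ρ₂ * ∏[ j < n ] latinColumn j (ρ₀ j) (ρ₁ j) (ρ₂ j))
    ≡⟨ ontoIndicator-*-ontoIndicator ρ₁ ρ₂ (λ j → latinColumn j (ρ₀ j) (ρ₁ j) (ρ₂ j)) ⟩
  ∑[ T ∈ subsets n ] ∑[ S ∈ subsets n ] signedColumns T S M
    ∎
  where
  open ≡-Reasoning
  ρ₀ ρ₁ ρ₂ : Fin n → Fin n
  ρ₀ = lookup r₀
  ρ₁ = lookup r₁
  ρ₂ = lookup r₂

∑-signedColumns : ∀ (T S : Subset n) →
                  ∑[ M ∈ allMatrices 3 n ] signedColumns T S M ≡ sign T * sign S * ∏[ j < n ] columnValue (χ T) (χ S) j
∑-signedColumns {n} T S = begin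
  ∑[ M ∈ allMatrices 3 n ] (sign T * sign S * ∏[ j < n ] columnTerm T S j (column j M))
    ≡⟨ sym (*-distribˡ-∑ₗ (sign T * sign S) (allMatrices 3 n) _) ⟩
  sign T * sign S * ∑[ M ∈ allMatrices 3 n ] ∏[ j < n ] columnTerm T S j (column j M)
    ≡⟨ cong (sign T * sign S *_) (∑-matrices-∏ 3 (columnTerm T S)) ⟩
  sign T * sign S * ∏[ j < n ] ∑[ c ∈ allVecs n 3 ] columnTerm T S j c
    ≡⟨ cong (sign T * sign S *_) (∏-cong λ j → trans (∑-allVecs-3 (columnTerm T S j)) (∑-latinColumn (χ T) (χ S) j)) ⟩
  sign T * sign S * ∏[ j < n ] columnValue (χ T) (χ S) j
    ∎
  where open ≡-Reasoning

-- (s₀₀, s₁₀, s₀₁, s₁₁), where s_xy counts the indices j with [j ∉ T] = x and [j ∉ S] = y.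
Quad : Set
Quad = ℕ × ℕ × ℕ × ℕ

qsum : Quad → ℕ
qsum (a , b , c , d) = a ℕ.+ b ℕ.+ c ℕ.+ d

_≟Q_ : DecidableEquality Quad
_≟Q_ = ≡-dec ℕ._≟_ (≡-dec ℕ._≟_ (≡-dec ℕ._≟_ ℕ._≟_))

addKind : Side → Side → Quad → Quad
addKind inside  inside  (a , b , c , d) = (suc a , b , c , d)
addKind outside inside  (a , b , c , d) = (a , suc b , c , d)
addKind inside  outside (a , b , c , d) = (a , b , suc c , d)
addKind outside outside (a , b , c , d) = (a , b , c , suc d)

qsum-addKind : ∀ x y k → qsum (addKind x y k) ≡ suc (qsum k)
qsum-addKind inside  inside  _               = refl
qsum-addKind outside inside  (a , b , c , d) = cong (λ ab → ab ℕ.+ c ℕ.+ d) (ℕP.+-suc a b)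
qsum-addKind inside  outside (a , b , c , d) = cong (ℕ._+ d) (ℕP.+-suc (a ℕ.+ b) c)
qsum-addKind outside outside (a , b , c , d) = ℕP.+-suc (a ℕ.+ b ℕ.+ c) d

kindCount : Subset n → Subset n → Quad
kindCount []      []      = (0 , 0 , 0 , 0)
kindCount (x ∷ T) (y ∷ S) = addKind x y (kindCount T S)

qsum-kindCount : ∀ (T S : Subset n) → qsum (kindCount T S) ≡ n
qsum-kindCount []      []      = refl
qsum-kindCount (x ∷ T) (y ∷ S) = trans (qsum-addKind x y (kindCount T S)) (cong suc (qsum-kindCount T S))

kindSum : Quad → (Side → Side → ℤ) → ℤ
kindSum (a , b , c , d) h = + a * h inside inside + + b * h outside inside + + c * h inside outside + + d * h outside outside

kindProduct : Quad → (Side → Side → ℤ) → ℤ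
kindProduct (a , b , c , d) v = v inside inside ^ a * v outside inside ^ b * v inside outside ^ c * v outside outside ^ d

kindSum-addKind : ∀ x y k (h : Side → Side → ℤ) → kindSum (addKind x y k) h ≡ h x y + kindSum k h
kindSum-addKind x y (a , b , c , d) h = go x y
  where
  h₀₀ = h inside inside
  h₁₀ = h outside inside
  h₀₁ = h inside outside
  h₁₁ = h outside outside
  go : ∀ x y → kindSum (addKind x y (a , b , c , d)) h ≡ h x y + kindSum (a , b , c , d) h
  go inside  inside  = step₁ (+ a) (+ b) (+ c) (+ d) h₀₀ h₁₀ h₀₁ h₁₁
    where step₁ : ∀ a b c d w x y z → (1ℤ + a) * w + b * x + c * y + d * z ≡ w + (a * w + b * x + c * y + d * z)
          step₁ = solve-∀
  go outside inside  = step₂ (+ a) (+ b) (+ c) (+ d) h₀₀ h₁₀ h₀₁ h₁₁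
    where step₂ : ∀ a b c d w x y z → a * w + (1ℤ + b) * x + c * y + d * z ≡ x + (a * w + b * x + c * y + d * z)
          step₂ = solve-∀
  go inside  outside = step₃ (+ a) (+ b) (+ c) (+ d) h₀₀ h₁₀ h₀₁ h₁₁
    where step₃ : ∀ a b c d w x y z → a * w + b * x + (1ℤ + c) * y + d * z ≡ y + (a * w + b * x + c * y + d * z)
          step₃ = solve-∀
  go outside outside = step₄ (+ a) (+ b) (+ c) (+ d) h₀₀ h₁₀ h₀₁ h₁₁
    where step₄ : ∀ a b c d w x y z → a * w + b * x + c * y + (1ℤ + d) * z ≡ z + (a * w + b * x + c * y + d * z)
          step₄ = solve-∀

kindProduct-addKind : ∀ x y k (v : Side → Side → ℤ) → kindProduct (addKind x y k) v ≡ v x y * kindProduct k v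
kindProduct-addKind x y (a , b , c , d) v = go x y
  where
  pow₀₀ = v inside inside ^ a
  pow₁₀ = v outside inside ^ b
  pow₀₁ = v inside outside ^ c
  pow₁₁ = v outside outside ^ d
  go : ∀ x y → kindProduct (addKind x y (a , b , c , d)) v ≡ v x y * kindProduct (a , b , c , d) v
  go inside  inside  = step₁ (v inside inside) pow₀₀ pow₁₀ pow₀₁ pow₁₁
    where step₁ : ∀ w A B C D → w * A * B * C * D ≡ w * (A * B * C * D)
          step₁ = solve-∀
  go outside inside  = step₂ (v outside inside) pow₀₀ pow₁₀ pow₀₁ pow₁₁
    where step₂ : ∀ w A B C D → A * (w * B) * C * D ≡ w * (A * B * C * D)
          step₂ = solve-∀
  go inside  outside = step₃ (v inside outside) pow₀₀ pow₁₀ pow₀₁ pow₁₁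
    where step₃ : ∀ w A B C D → A * B * (w * C) * D ≡ w * (A * B * C * D)
          step₃ = solve-∀
  go outside outside = step₄ (v outside outside) pow₀₀ pow₁₀ pow₀₁ pow₁₁
    where step₄ : ∀ w A B C D → A * B * C * (w * D) ≡ w * (A * B * C * D)
          step₄ = solve-∀

∑-byKind : ∀ (T S : Subset n) (h : Side → Side → ℤ) → ∑[ j < n ] h (lookup T j) (lookup S j) ≡ kindSum (kindCount T S) h
∑-byKind []      []      h = refl
∑-byKind (x ∷ T) (y ∷ S) h = trans (cong (_+_ (h x y)) (∑-byKind T S h)) (sym (kindSum-addKind x y (kindCount T S) h))

∏-byKind : ∀ (T S : Subset n) (v : Side → Side → ℤ) → ∏[ j < n ] v (lookup T j) (lookup S j) ≡ kindProduct (kindCount T S) v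
∏-byKind []      []      v = refl
∏-byKind (x ∷ T) (y ∷ S) v = trans (cong (v x y *_) (∏-byKind T S v)) (sym (kindProduct-addKind x y (kindCount T S) v))

kindWeight : Quad → Side → Side → ℤ
kindWeight (a , b , c , d) inside  inside  = g (+ a - 1ℤ) (+ b) (+ c) (+ d + 1ℤ)
kindWeight (a , b , c , d) outside inside  = - g (+ a) (+ b - 1ℤ) (+ c) (+ d + 1ℤ)
kindWeight (a , b , c , d) inside  outside = - g (+ a) (+ b) (+ c - 1ℤ) (+ d + 1ℤ)
kindWeight (a , b , c , d) outside outside = g (+ a) (+ b) (+ c) (+ d)

signedAvoidingPairs≡kindWeight : ∀ a b c d x y →
  sideSign x * sideSign y * avoidingPairs (+ a + + c) (+ a + + b) (+ a) (fromSide x) (fromSide y) ≡ kindWeight (a , b , c , d) x y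
signedAvoidingPairs≡kindWeight a b c d inside  inside  = case₀₀ (+ a) (+ b) (+ c)
  where case₀₀ : ∀ a b c → 1ℤ * 1ℤ * ((a + c - 1ℤ) * (a + b - 1ℤ) - (a - 1ℤ * 1ℤ)) ≡ (a - 1ℤ + b) * (a - 1ℤ + c) - (a - 1ℤ)
        case₀₀ = solve-∀
signedAvoidingPairs≡kindWeight a b c d outside inside  = case₁₀ (+ a) (+ b) (+ c)
  where case₁₀ : ∀ a b c → -1ℤ * 1ℤ * ((a + c - 0ℤ) * (a + b - 1ℤ) - (a - 0ℤ * 1ℤ)) ≡ - ((a + (b - 1ℤ)) * (a + c) - a)
        case₁₀ = solve-∀
signedAvoidingPairs≡kindWeight a b c d inside  outside = case₀₁ (+ a) (+ b) (+ c)
  where case₀₁ : ∀ a b c → 1ℤ * -1ℤ * ((a + c - 1ℤ) * (a + b - 0ℤ) - (a - 1ℤ * 0ℤ)) ≡ - ((a + b) * (a + (c - 1ℤ)) - a)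
        case₀₁ = solve-∀
signedAvoidingPairs≡kindWeight a b c d outside outside = case₁₁ (+ a) (+ b) (+ c)
  where case₁₁ : ∀ a b c → -1ℤ * -1ℤ * ((a + c - 0ℤ) * (a + b - 0ℤ) - (a - 0ℤ * 0ℤ)) ≡ (a + b) * (a + c) - a
        case₁₁ = solve-∀

signedColumnValue : ∀ (T S : Subset n) j →
  sideSign (lookup T j) * sideSign (lookup S j) * columnValue (χ T) (χ S) j ≡ kindWeight (kindCount T S) (lookup T j) (lookup S j)
signedColumnValue {n} T S j with kindCount T S in kinds≡
... | (a , b , c , d) = trans
  (cong₂ (λ sizeT (sizeS , sizeT∩S) → sideSign x * sideSign y * avoidingPairs sizeT sizeS sizeT∩S (fromSide x) (fromSide y))
         (trans (bySize (λ x _ → fromSide x)) (sizeT (+ a) (+ b) (+ c) (+ d)))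
         (cong₂ _,_ (trans (bySize (λ _ y → fromSide y)) (sizeS (+ a) (+ b) (+ c) (+ d)))
                    (trans (bySize (λ x y → fromSide x * fromSide y)) (sizeT∩S (+ a) (+ b) (+ c) (+ d)))))
  (signedAvoidingPairs≡kindWeight a b c d x y)
  where
  x = lookup T j
  y = lookup S j
  bySize : ∀ h → ∑[ i < n ] h (lookup T i) (lookup S i) ≡ kindSum (a , b , c , d) h
  bySize h = trans (∑-byKind T S h) (cong (λ q → kindSum q h) kinds≡)
  sizeT : ∀ a b c d → a * 1ℤ + b * 0ℤ + c * 1ℤ + d * 0ℤ ≡ a + c
  sizeT = solve-∀
  sizeS : ∀ a b c d → a * 1ℤ + b * 1ℤ + c * 0ℤ + d * 0ℤ ≡ a + b
  sizeS = solve-∀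
  sizeT∩S : ∀ a b c d → a * (1ℤ * 1ℤ) + b * (0ℤ * 1ℤ) + c * (1ℤ * 0ℤ) + d * (0ℤ * 0ℤ) ≡ a
  sizeT∩S = solve-∀

signedColumnValues-byKind : ∀ (T S : Subset n) →
  sign T * sign S * ∏[ j < n ] columnValue (χ T) (χ S) j ≡ kindProduct (kindCount T S) (kindWeight (kindCount T S))
signedColumnValues-byKind {n} T S = begin
  sign T * sign S * ∏ value
    ≡⟨ cong (_* ∏ value) (sym (∏-distrib-* (sideSign ∘ lookup T) (sideSign ∘ lookup S))) ⟩
  ∏[ j < n ] (sideSign (lookup T j) * sideSign (lookup S j)) * ∏ value
    ≡⟨ sym (∏-distrib-* (λ j → sideSign (lookup T j) * sideSign (lookup S j)) value) ⟩
  ∏[ j < n ] (sideSign (lookup T j) * sideSign (lookup S j) * value j)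
    ≡⟨ ∏-cong (signedColumnValue T S) ⟩
  ∏[ j < n ] kindWeight (kindCount T S) (lookup T j) (lookup S j)
    ≡⟨ ∏-byKind T S (kindWeight (kindCount T S)) ⟩
  kindProduct (kindCount T S) (kindWeight (kindCount T S))
    ∎
  where
  open ≡-Reasoning
  value = columnValue (χ T) (χ S)

-- Multinomial coefficients

count : Side → Side → Quad → ℕ
count inside  inside  (a , b , c , d) = a
count outside inside  (a , b , c , d) = b
count inside  outside (a , b , c , d) = c
count outside outside (a , b , c , d) = d

removeKind : Side → Side → Quad → Maybe Quad
removeKind inside  inside  (suc a , b , c , d) = just (a , b , c , d)
removeKind outside inside  (a , suc b , c , d) = just (a , b , c , d)
removeKind inside  outside (a , b , suc c , d) = just (a , b , c , d)
removeKind outside outside (a , b , c , suc d) = just (a , b , c , d)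
removeKind _       _       _                   = nothing

data Removal (x y : Side) (q : Quad) : Maybe Quad → Set where
  removed : ∀ k → addKind x y k ≡ q → Removal x y q (just k)
  absent  : count x y q ≡ 0 → Removal x y q nothing

removal : ∀ x y q → Removal x y q (removeKind x y q)
removal inside  inside  (suc a , b , c , d) = removed _ refl
removal inside  inside  (zero  , b , c , d) = absent refl
removal outside inside  (a , suc b , c , d) = removed _ refl
removal outside inside  (a , zero  , c , d) = absent refl
removal inside  outside (a , b , suc c , d) = removed _ refl
removal inside  outside (a , b , zero  , d) = absent refl
removal outside outside (a , b , c , suc d) = removed _ refl
removal outside outside (a , b , c , zero ) = absent refl

removeKind-addKind : ∀ x y k → removeKind x y (addKind x y k) ≡ just k
removeKind-addKind inside  inside  _ = refl
removeKind-addKind outside inside  _ = refl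
removeKind-addKind inside  outside _ = refl
removeKind-addKind outside outside _ = refl

count-addKind : ∀ x y k → count x y (addKind x y k) ≡ suc (count x y k)
count-addKind inside  inside  _ = refl
count-addKind outside inside  _ = refl
count-addKind inside  outside _ = refl
count-addKind outside outside _ = refl

factorials : Quad → ℕ
factorials (a , b , c , d) = a ! ℕ.* b ! ℕ.* c ! ℕ.* d !

factorials-addKind : ∀ x y k → factorials (addKind x y k) ≡ suc (count x y k) ℕ.* factorials k
factorials-addKind x y (a , b , c , d) = go x y
  where
  go : ∀ x y → factorials (addKind x y (a , b , c , d)) ≡ suc (count x y (a , b , c , d)) ℕ.* factorials (a , b , c , d)
  go inside  inside  = step₁ (suc a) (a !) (b !) (c !) (d !)
    where step₁ : ∀ s A B C D → s ℕ.* A ℕ.* B ℕ.* C ℕ.* D ≡ s ℕ.* (A ℕ.* B ℕ.* C ℕ.* D)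
          step₁ = ℕ-Solver.solve-∀
  go outside inside  = step₂ (suc b) (a !) (b !) (c !) (d !)
    where step₂ : ∀ s A B C D → A ℕ.* (s ℕ.* B) ℕ.* C ℕ.* D ≡ s ℕ.* (A ℕ.* B ℕ.* C ℕ.* D)
          step₂ = ℕ-Solver.solve-∀
  go inside  outside = step₃ (suc c) (a !) (b !) (c !) (d !)
    where step₃ : ∀ s A B C D → A ℕ.* B ℕ.* (s ℕ.* C) ℕ.* D ≡ s ℕ.* (A ℕ.* B ℕ.* C ℕ.* D)
          step₃ = ℕ-Solver.solve-∀
  go outside outside = step₄ (suc d) (a !) (b !) (c !) (d !)
    where step₄ : ∀ s A B C D → A ℕ.* B ℕ.* C ℕ.* (s ℕ.* D) ≡ s ℕ.* (A ℕ.* B ℕ.* C ℕ.* D)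
          step₄ = ℕ-Solver.solve-∀

factorials≢0 : ∀ q → ℕ.NonZero (factorials q)
factorials≢0 (a , b , c , d) = ℕP.m*n≢0 _ _ {{ℕP.m*n≢0 _ _ {{ℕP.m*n≢0 _ _ {{a ℕP.!≢0}} {{b ℕP.!≢0}}}} {{c ℕP.!≢0}}}} {{d ℕP.!≢0}}

sumOverKinds : (Side → Side → ℕ) → ℕ
sumOverKinds h = h inside inside ℕ.+ h inside outside ℕ.+ h outside inside ℕ.+ h outside outside

-- The multinomial coefficient through its recurrence in n; multinomial4 divides n! by the factorials,
-- which is of no use for induction.
multinomial : ℕ → Quad → ℕ
multinomial zero    (zero , zero , zero , zero) = 1
multinomial zero    _                           = 0
multinomial (suc n) q = sumOverKinds λ x y → maybe (multinomial n) 0 (removeKind x y q)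

shifted-*-factorials : ∀ n x y q → (∀ k → qsum k ≡ n → multinomial n k ℕ.* factorials k ≡ n !) →
                       qsum q ≡ suc n → maybe (multinomial n) 0 (removeKind x y q) ℕ.* factorials q ≡ count x y q ℕ.* n !
shifted-*-factorials n x y q multinomial-*-factorialsₙ qsum≡ with removeKind x y q | removal x y q
... | nothing | absent count≡0 = sym (cong (ℕ._* n !) count≡0)
... | just k  | removed k refl = begin
  multinomial n k ℕ.* factorials (addKind x y k)
    ≡⟨ cong (multinomial n k ℕ.*_) (factorials-addKind x y k) ⟩
  multinomial n k ℕ.* (suc (count x y k) ℕ.* factorials k)
    ≡⟨ ℕP.*-comm (multinomial n k) _ ⟩
  suc (count x y k) ℕ.* factorials k ℕ.* multinomial n k
    ≡⟨ ℕP.*-assoc (suc (count x y k)) (factorials k) (multinomial n k) ⟩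
  suc (count x y k) ℕ.* (factorials k ℕ.* multinomial n k)
    ≡⟨ cong (suc (count x y k) ℕ.*_) (trans (ℕP.*-comm (factorials k) _) (multinomial-*-factorialsₙ k qsum-k)) ⟩
  suc (count x y k) ℕ.* n !
    ≡⟨ cong (ℕ._* n !) (sym (count-addKind x y k)) ⟩
  count x y (addKind x y k) ℕ.* n !
    ∎
  where
  open ≡-Reasoning
  qsum-k : qsum k ≡ n
  qsum-k = ℕP.suc-injective (trans (sym (qsum-addKind x y k)) qsum≡)

multinomial-*-factorials : ∀ n q → qsum q ≡ n → multinomial n q ℕ.* factorials q ≡ n !
multinomial-*-factorials zero    (zero  , zero  , zero  , zero ) _  = refl
multinomial-*-factorials zero    (suc _ , _     , _     , _    ) ()
multinomial-*-factorials zero    (zero  , suc _ , _     , _    ) ()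
multinomial-*-factorials zero    (zero  , zero  , suc _ , _    ) ()
multinomial-*-factorials zero    (zero  , zero  , zero  , suc _) ()
multinomial-*-factorials (suc n) q@(a , b , c , d) qsum≡ = begin
  sumOverKinds shifted ℕ.* factorials q
    ≡⟨ distrib (shifted inside inside) (shifted inside outside) (shifted outside inside) (shifted outside outside) (factorials q) ⟩
  sumOverKinds (λ x y → shifted x y ℕ.* factorials q)
    ≡⟨ cong₂ ℕ._+_ (cong₂ ℕ._+_ (cong₂ ℕ._+_ (shift inside inside) (shift inside outside)) (shift outside inside))
                   (shift outside outside) ⟩
  a ℕ.* n ! ℕ.+ c ℕ.* n ! ℕ.+ b ℕ.* n ! ℕ.+ d ℕ.* n !
    ≡⟨ collect a b c d (n !) ⟩
  qsum q ℕ.* n !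
    ≡⟨ cong (ℕ._* n !) qsum≡ ⟩
  suc n !
    ∎
  where
  open ≡-Reasoning
  shifted : Side → Side → ℕ
  shifted x y = maybe (multinomial n) 0 (removeKind x y q)
  shift : ∀ x y → shifted x y ℕ.* factorials q ≡ count x y q ℕ.* n !
  shift x y = shifted-*-factorials n x y q (multinomial-*-factorials n) qsum≡
  distrib : ∀ p q r s f → (p ℕ.+ q ℕ.+ r ℕ.+ s) ℕ.* f ≡ p ℕ.* f ℕ.+ q ℕ.* f ℕ.+ r ℕ.* f ℕ.+ s ℕ.* f
  distrib = ℕ-Solver.solve-∀
  collect : ∀ a b c d f → a ℕ.* f ℕ.+ c ℕ.* f ℕ.+ b ℕ.* f ℕ.+ d ℕ.* f ≡ (a ℕ.+ b ℕ.+ c ℕ.+ d) ℕ.* f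
  collect = ℕ-Solver.solve-∀

𝟙-addKind≟ : ∀ x y k q → 𝟙 (addKind x y k ≟Q q) ≡ maybe (λ k′ → 𝟙 (k ≟Q k′)) 0ℤ (removeKind x y q)
𝟙-addKind≟ x y k q with removeKind x y q | removal x y q
... | just k′ | removed k′ refl = 𝟙-cong (addKind x y k ≟Q addKind x y k′) (k ≟Q k′) (mk⇔ addKind-injective (cong (addKind x y)))
  where addKind-injective : addKind x y k ≡ addKind x y k′ → k ≡ k′
        addKind-injective e = just-injective (trans (sym (removeKind-addKind x y k)) (trans (cong (removeKind x y) e) (removeKind-addKind x y k′)))
... | nothing | absent count≡0 = 𝟙-no (addKind x y k ≟Q q) λ e → ℕP.1+n≢0 (trans (sym (count-addKind x y k)) (trans (cong (count x y) e) count≡0))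

kindCount-fiberSize : ∀ n q → ∑[ T ∈ subsets n ] ∑[ S ∈ subsets n ] 𝟙 (kindCount T S ≟Q q) ≡ + multinomial n q
kindCount-fiberSize zero    (zero  , zero  , zero  , zero ) = refl
kindCount-fiberSize zero    (suc _ , _     , _     , _    ) = refl
kindCount-fiberSize zero    (zero  , suc _ , _     , _    ) = refl
kindCount-fiberSize zero    (zero  , zero  , suc _ , _    ) = refl
kindCount-fiberSize zero    (zero  , zero  , zero  , suc _) = refl
kindCount-fiberSize (suc n) q = begin
  ∑[ T ∈ subsets (suc n) ] ∑[ S ∈ subsets (suc n) ] 𝟙 (kindCount T S ≟Q q)
    ≡⟨ ∑ₗ-cons-pairs sides (subsets n) (λ T → ∑[ S ∈ subsets (suc n) ] 𝟙 (kindCount T S ≟Q q)) ⟩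
  ∑[ x ∈ sides ] ∑[ T ∈ subsets n ] ∑[ S ∈ subsets (suc n) ] 𝟙 (kindCount (x ∷ T) S ≟Q q)
    ≡⟨ ∑ₗ-cong sides (λ x → ∑ₗ-cong (subsets n) λ T → ∑ₗ-cons-pairs sides (subsets n) (λ S → 𝟙 (kindCount (x ∷ T) S ≟Q q))) ⟩
  ∑[ x ∈ sides ] ∑[ T ∈ subsets n ] ∑[ y ∈ sides ] ∑[ S ∈ subsets n ] 𝟙 (addKind x y (kindCount T S) ≟Q q)
    ≡⟨ ∑ₗ-cong sides (λ x → ∑ₗ-comm (subsets n) sides λ T y → ∑[ S ∈ subsets n ] 𝟙 (addKind x y (kindCount T S) ≟Q q)) ⟩
  ∑[ x ∈ sides ] ∑[ y ∈ sides ] ∑[ T ∈ subsets n ] ∑[ S ∈ subsets n ] 𝟙 (addKind x y (kindCount T S) ≟Q q)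
    ≡⟨ ∑ₗ-cong sides (λ x → ∑ₗ-cong sides λ y → fiberSize-addKind x y) ⟩
  ∑[ x ∈ sides ] ∑[ y ∈ sides ] (+ shifted x y)
    ≡⟨ sum₄ (+ shifted inside inside) (+ shifted inside outside) (+ shifted outside inside) (+ shifted outside outside) ⟩
  + multinomial (suc n) q
    ∎
  where
  open ≡-Reasoning
  shifted : Side → Side → ℕ
  shifted x y = maybe (multinomial n) 0 (removeKind x y q)
  fiberSize-addKind : ∀ x y → ∑[ T ∈ subsets n ] ∑[ S ∈ subsets n ] 𝟙 (addKind x y (kindCount T S) ≟Q q) ≡ + shifted x y
  fiberSize-addKind x y = trans (∑ₗ-cong (subsets n) λ T → ∑ₗ-cong (subsets n) λ S → 𝟙-addKind≟ x y (kindCount T S) q)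
                                (byRemoval (removeKind x y q))
    where byRemoval : ∀ r → ∑[ T ∈ subsets n ] ∑[ S ∈ subsets n ] maybe (λ k′ → 𝟙 (kindCount T S ≟Q k′)) 0ℤ r
                            ≡ + maybe (multinomial n) 0 r
          byRemoval (just k′) = kindCount-fiberSize n k′
          byRemoval nothing   = trans (∑ₗ-cong (subsets n) λ T → ∑ₗ-zero (subsets n)) (∑ₗ-zero (subsets n))
  sum₄ : ∀ a b c d → a + (b + 0ℤ) + (c + (d + 0ℤ) + 0ℤ) ≡ a + b + c + d
  sum₄ = solve-∀

∑-compositions4 : ∀ n (G : Quad → ℤ) →
  ∑[ q ∈ compositions4 n ] G q ≡
  ∑[ a ∈ upTo (suc n) ] ∑[ b ∈ upTo (suc (n ∸ a)) ] ∑[ c ∈ upTo (suc (n ∸ a ∸ b)) ] G (a , b , c , n ∸ a ∸ b ∸ c)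
∑-compositions4 n G =
  trans (∑ₗ-concatMap (λ a → concatMap (λ b → map (λ c → (a , b , c , n ∸ a ∸ b ∸ c)) (upTo (suc (n ∸ a ∸ b))))
                                      (upTo (suc (n ∸ a))))
                      (upTo (suc n)) G) (∑ₗ-cong (upTo (suc n)) λ a →
  trans (∑ₗ-concatMap (λ b → map (λ c → (a , b , c , n ∸ a ∸ b ∸ c)) (upTo (suc (n ∸ a ∸ b)))) (upTo (suc (n ∸ a))) G)
        (∑ₗ-cong (upTo (suc (n ∸ a))) λ b →
  ∑ₗ-map (λ c → (a , b , c , n ∸ a ∸ b ∸ c)) (upTo (suc (n ∸ a ∸ b))) G))

qsum-fill : ∀ {n a b c} → a ℕ.≤ n → b ℕ.≤ n ∸ a → c ℕ.≤ n ∸ a ∸ b → qsum (a , b , c , n ∸ a ∸ b ∸ c) ≡ n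
qsum-fill {n} {a} {b} {c} a≤n b≤n∸a c≤n∸a∸b = begin
  a ℕ.+ b ℕ.+ c ℕ.+ (n ∸ a ∸ b ∸ c)      ≡⟨ trans (ℕP.+-assoc (a ℕ.+ b) c _) (ℕP.+-assoc a b _) ⟩
  a ℕ.+ (b ℕ.+ (c ℕ.+ (n ∸ a ∸ b ∸ c)))  ≡⟨ cong (λ r → a ℕ.+ (b ℕ.+ r)) (ℕP.m+[n∸m]≡n c≤n∸a∸b) ⟩
  a ℕ.+ (b ℕ.+ (n ∸ a ∸ b))              ≡⟨ cong (a ℕ.+_) (ℕP.m+[n∸m]≡n b≤n∸a) ⟩
  a ℕ.+ (n ∸ a)                          ≡⟨ ℕP.m+[n∸m]≡n a≤n ⟩
  n                                      ∎
  where open ≡-Reasoning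

∑-compositions4-cong : ∀ n {F G : Quad → ℤ} → (∀ q → qsum q ≡ n → F q ≡ G q) →
                       ∑ₗ (compositions4 n) F ≡ ∑ₗ (compositions4 n) G
∑-compositions4-cong n {F} {G} F≗G = begin
  ∑ₗ (compositions4 n) F
    ≡⟨ ∑-compositions4 n F ⟩
  ∑[ a ∈ upTo (suc n) ] ∑[ b ∈ upTo (suc (n ∸ a)) ] ∑[ c ∈ upTo (suc (n ∸ a ∸ b)) ] F (a , b , c , n ∸ a ∸ b ∸ c)
    ≡⟨ ∑ₗ-cong-∈ (upTo (suc n)) (λ {a} a∈ → ∑ₗ-cong-∈ (upTo (suc (n ∸ a))) λ {b} b∈ → ∑ₗ-cong-∈ (upTo (suc (n ∸ a ∸ b))) λ {c} c∈ →
         F≗G (a , b , c , n ∸ a ∸ b ∸ c) (qsum-fill (bound a∈) (bound b∈) (bound c∈))) ⟩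
  ∑[ a ∈ upTo (suc n) ] ∑[ b ∈ upTo (suc (n ∸ a)) ] ∑[ c ∈ upTo (suc (n ∸ a ∸ b)) ] G (a , b , c , n ∸ a ∸ b ∸ c)
    ≡⟨ sym (∑-compositions4 n G) ⟩
  ∑ₗ (compositions4 n) G
    ∎
  where
  open ≡-Reasoning
  bound : ∀ {x m} → x ∈ upTo (suc m) → x ℕ.≤ m
  bound = ℕ.s≤s⁻¹ ∘ ∈-upTo⁻

∑-upTo-δ : ∀ {k m} → k ℕ.< m → (f : ℕ → ℤ) → ∑[ x ∈ upTo m ] (𝟙 (k ℕ.≟ x) * f x) ≡ f k
∑-upTo-δ {k} {m} k<m f = begin
  ∑[ x ∈ upTo m ] (𝟙 (k ℕ.≟ x) * f x)
    ≡⟨ ∑ₗ-applyUpTo (λ x → x) m _ ⟩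
  ∑[ i < m ] (𝟙 (k ℕ.≟ toℕ i) * f (toℕ i))
    ≡⟨ sum-cong-≗ (λ i → cong (_* f (toℕ i)) (𝟙-cong (k ℕ.≟ toℕ i) (i Fin.≟ fromℕ< k<m) (mk⇔ to (from i)))) ⟩
  ∑[ i < m ] (𝟙 (i Fin.≟ fromℕ< k<m) * f (toℕ i))
    ≡⟨ ∑-δ (fromℕ< k<m) (f ∘ toℕ) ⟩
  f (toℕ (fromℕ< k<m))
    ≡⟨ cong f (Fin.toℕ-fromℕ< k<m) ⟩
  f k
    ∎
  where
  open ≡-Reasoning
  to : ∀ {i} → k ≡ toℕ i → i ≡ fromℕ< k<m
  to k≡i = Fin.toℕ-injective (trans (sym k≡i) (sym (Fin.toℕ-fromℕ< k<m)))
  from : ∀ i → i ≡ fromℕ< k<m → k ≡ toℕ i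
  from i refl = sym (Fin.toℕ-fromℕ< k<m)

qsum-∸ : ∀ a b c d → qsum (a , b , c , d) ∸ a ≡ b ℕ.+ c ℕ.+ d
qsum-∸ zero    b c d = refl
qsum-∸ (suc a) b c d = qsum-∸ a b c d

qsum-∸-bounds : ∀ k₁ k₂ k₃ k₄ → let n = qsum (k₁ , k₂ , k₃ , k₄) in
                k₁ ℕ.< suc n × k₂ ℕ.< suc (n ∸ k₁) × k₃ ℕ.< suc (n ∸ k₁ ∸ k₂) × n ∸ k₁ ∸ k₂ ∸ k₃ ≡ k₄
qsum-∸-bounds k₁ k₂ k₃ k₄ =
  ℕ.s≤s (ℕP.≤-trans (ℕP.m≤m+n k₁ k₂) (ℕP.≤-trans (ℕP.m≤m+n _ k₃) (ℕP.m≤m+n _ k₄))) ,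
  ℕ.s≤s (subst (k₂ ℕ.≤_) (sym rest₁) (ℕP.≤-trans (ℕP.m≤m+n k₂ k₃) (ℕP.m≤m+n _ k₄))) ,
  ℕ.s≤s (subst (k₃ ℕ.≤_) (sym rest₂) (ℕP.m≤m+n k₃ k₄)) ,
  trans (cong (_∸ k₃) rest₂) (ℕP.m+n∸m≡n k₃ k₄)
  where
  rest₁ : qsum (k₁ , k₂ , k₃ , k₄) ∸ k₁ ≡ k₂ ℕ.+ k₃ ℕ.+ k₄
  rest₁ = qsum-∸ k₁ k₂ k₃ k₄
  rest₂ : qsum (k₁ , k₂ , k₃ , k₄) ∸ k₁ ∸ k₂ ≡ k₃ ℕ.+ k₄
  rest₂ = trans (cong (_∸ k₂) (trans rest₁ (ℕP.+-assoc k₂ k₃ k₄))) (ℕP.m+n∸m≡n k₂ (k₃ ℕ.+ k₄))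

𝟙-≟Q-determined : ∀ {k₁ k₂ k₃ k₄} a b c d → (k₁ ≡ a → k₂ ≡ b → k₃ ≡ c → k₄ ≡ d) →
                  𝟙 ((k₁ , k₂ , k₃ , k₄) ≟Q (a , b , c , d)) ≡ 𝟙 (k₁ ℕ.≟ a) * (𝟙 (k₂ ℕ.≟ b) * 𝟙 (k₃ ℕ.≟ c))
𝟙-≟Q-determined {k₁} {k₂} {k₃} a b c d fourth = isIndicator-unique (𝟙-isIndicator (_ ≟Q (a , b , c , d)))
  (isIndicator-⇔ (mk⇔ (λ { (refl , refl , refl) → cong (λ x → (k₁ , k₂ , k₃ , x)) (fourth refl refl refl) })
                      (λ e → cong proj₁ e , cong (proj₁ ∘ proj₂) e , cong (proj₁ ∘ proj₂ ∘ proj₂) e))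
    (isIndicator-* (𝟙-isIndicator (k₁ ℕ.≟ a)) (isIndicator-* (𝟙-isIndicator (k₂ ℕ.≟ b)) (𝟙-isIndicator (k₃ ℕ.≟ c)))))

-- Every quadruple with sum n occurs in compositions4 n exactly once, namely at a = k₁, b = k₂, c = k₃.
∑-compositions4-δ : ∀ k (F : Quad → ℤ) → ∑[ q ∈ compositions4 (qsum k) ] (𝟙 (k ≟Q q) * F q) ≡ F k
∑-compositions4-δ k@(k₁ , k₂ , k₃ , k₄) F with qsum-∸-bounds k₁ k₂ k₃ k₄
... | k₁< , k₂< , k₃< , rest = begin
  ∑[ q ∈ compositions4 total ] (𝟙 (k ≟Q q) * F q)
    ≡⟨ ∑-compositions4 total (λ q → 𝟙 (k ≟Q q) * F q) ⟩
  ∑[ a ∈ upTo (suc total) ] ∑[ b ∈ upTo (suc (total ∸ a)) ] ∑[ c ∈ upTo (suc (total ∸ a ∸ b)) ] (𝟙 (k ≟Q (a , b , c , total ∸ a ∸ b ∸ c)) * F (a , b , c , total ∸ a ∸ b ∸ c))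
    ≡⟨ ∑ₗ-cong (upTo (suc total)) factor ⟩
  ∑[ a ∈ upTo (suc total) ] (𝟙 (k₁ ℕ.≟ a) * ∑[ b ∈ upTo (suc (total ∸ a)) ] (𝟙 (k₂ ℕ.≟ b) * ∑[ c ∈ upTo (suc (total ∸ a ∸ b)) ] X a b c))
    ≡⟨ ∑-upTo-δ k₁< (λ a → ∑[ b ∈ upTo (suc (total ∸ a)) ] (𝟙 (k₂ ℕ.≟ b) * ∑[ c ∈ upTo (suc (total ∸ a ∸ b)) ] X a b c)) ⟩
  ∑[ b ∈ upTo (suc (total ∸ k₁)) ] (𝟙 (k₂ ℕ.≟ b) * ∑[ c ∈ upTo (suc (total ∸ k₁ ∸ b)) ] X k₁ b c)
    ≡⟨ ∑-upTo-δ k₂< (λ b → ∑[ c ∈ upTo (suc (total ∸ k₁ ∸ b)) ] X k₁ b c) ⟩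
  ∑[ c ∈ upTo (suc (total ∸ k₁ ∸ k₂)) ] (𝟙 (k₃ ℕ.≟ c) * F (k₁ , k₂ , c , total ∸ k₁ ∸ k₂ ∸ c))
    ≡⟨ ∑-upTo-δ k₃< (λ c → F (k₁ , k₂ , c , total ∸ k₁ ∸ k₂ ∸ c)) ⟩
  F (k₁ , k₂ , k₃ , total ∸ k₁ ∸ k₂ ∸ k₃)
    ≡⟨ cong (λ d → F (k₁ , k₂ , k₃ , d)) rest ⟩
  F k
    ∎
  where
  open ≡-Reasoning
  total = qsum k
  X : ℕ → ℕ → ℕ → ℤ
  X a b c = 𝟙 (k₃ ℕ.≟ c) * F (a , b , c , total ∸ a ∸ b ∸ c)
  split : ∀ a b c → 𝟙 (k ≟Q (a , b , c , total ∸ a ∸ b ∸ c)) * F (a , b , c , total ∸ a ∸ b ∸ c) ≡ 𝟙 (k₁ ℕ.≟ a) * (𝟙 (k₂ ℕ.≟ b) * X a b c)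
  split a b c = trans (cong (_* F (a , b , c , total ∸ a ∸ b ∸ c)) (𝟙-≟Q-determined {k₁} {k₂} {k₃} {k₄} a b c _ λ { refl refl refl → sym rest }))
                      (assoc₃ (𝟙 (k₁ ℕ.≟ a)) (𝟙 (k₂ ℕ.≟ b)) (𝟙 (k₃ ℕ.≟ c)) (F (a , b , c , total ∸ a ∸ b ∸ c)))
    where assoc₃ : ∀ x y z w → x * (y * z) * w ≡ x * (y * (z * w))
          assoc₃ = solve-∀
  factor : ∀ a → ∑[ b ∈ upTo (suc (total ∸ a)) ] ∑[ c ∈ upTo (suc (total ∸ a ∸ b)) ] (𝟙 (k ≟Q (a , b , c , total ∸ a ∸ b ∸ c)) * F (a , b , c , total ∸ a ∸ b ∸ c))
                 ≡ 𝟙 (k₁ ℕ.≟ a) * ∑[ b ∈ upTo (suc (total ∸ a)) ] (𝟙 (k₂ ℕ.≟ b) * ∑[ c ∈ upTo (suc (total ∸ a ∸ b)) ] X a b c)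
  factor a = trans (∑ₗ-cong (upTo (suc (total ∸ a))) λ b →
                      trans (∑ₗ-cong (upTo (suc (total ∸ a ∸ b))) (split a b))
                     (trans (sym (*-distribˡ-∑ₗ (𝟙 (k₁ ℕ.≟ a)) (upTo (suc (total ∸ a ∸ b))) (λ c → 𝟙 (k₂ ℕ.≟ b) * X a b c)))
                            (cong (𝟙 (k₁ ℕ.≟ a) *_) (sym (*-distribˡ-∑ₗ (𝟙 (k₂ ℕ.≟ b)) (upTo (suc (total ∸ a ∸ b))) (X a b))))))
                   (sym (*-distribˡ-∑ₗ (𝟙 (k₁ ℕ.≟ a)) (upTo (suc (total ∸ a)))
                                       (λ b → 𝟙 (k₂ ℕ.≟ b) * ∑[ c ∈ upTo (suc (total ∸ a ∸ b)) ] X a b c)))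

∑-subsetPairs-byKind : ∀ n (F : Quad → ℤ) →
  ∑[ T ∈ subsets n ] ∑[ S ∈ subsets n ] F (kindCount T S) ≡ ∑[ q ∈ compositions4 n ] (+ multinomial n q * F q)
∑-subsetPairs-byKind n F = begin
  ∑[ T ∈ subsets n ] ∑[ S ∈ subsets n ] F (kindCount T S)
    ≡⟨ ∑ₗ-cong (subsets n) (λ T → ∑ₗ-cong (subsets n) λ S → sym (δ T S)) ⟩
  ∑[ T ∈ subsets n ] ∑[ S ∈ subsets n ] ∑[ q ∈ compositions4 n ] (𝟙 (kindCount T S ≟Q q) * F q)
    ≡⟨ ∑ₗ-cong (subsets n) (λ T → ∑ₗ-comm (subsets n) (compositions4 n) _) ⟩
  ∑[ T ∈ subsets n ] ∑[ q ∈ compositions4 n ] ∑[ S ∈ subsets n ] (𝟙 (kindCount T S ≟Q q) * F q)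
    ≡⟨ ∑ₗ-comm (subsets n) (compositions4 n) _ ⟩
  ∑[ q ∈ compositions4 n ] ∑[ T ∈ subsets n ] ∑[ S ∈ subsets n ] (𝟙 (kindCount T S ≟Q q) * F q)
    ≡⟨ ∑ₗ-cong (compositions4 n) (λ q → trans (∑ₗ-cong (subsets n) λ T → sym (*-distribʳ-∑ₗ (F q) (subsets n) _))
                                              (sym (*-distribʳ-∑ₗ (F q) (subsets n) _))) ⟩
  ∑[ q ∈ compositions4 n ] ((∑[ T ∈ subsets n ] ∑[ S ∈ subsets n ] 𝟙 (kindCount T S ≟Q q)) * F q)
    ≡⟨ ∑ₗ-cong (compositions4 n) (λ q → cong (_* F q) (kindCount-fiberSize n q)) ⟩
  ∑[ q ∈ compositions4 n ] (+ multinomial n q * F q)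
    ∎
  where
  open ≡-Reasoning
  δ : ∀ T S → ∑[ q ∈ compositions4 n ] (𝟙 (kindCount T S ≟Q q) * F q) ≡ F (kindCount T S)
  δ T S = subst (λ m → ∑[ q ∈ compositions4 m ] (𝟙 (kindCount T S ≟Q q) * F q) ≡ F (kindCount T S))
                (qsum-kindCount T S) (∑-compositions4-δ (kindCount T S) F)

multinomial4≡multinomial : ∀ n a b c d → qsum (a , b , c , d) ≡ n → multinomial4 n a b c d ≡ multinomial n (a , b , c , d)
multinomial4≡multinomial n a b c d qsum≡ =
  trans (ℕ./-congˡ {{factorials≢0 q}} (sym (multinomial-*-factorials n q qsum≡)))
        (ℕ.m*n/n≡m (multinomial n q) (factorials q) {{factorials≢0 q}})
  where q = (a , b , c , d)

neg-^ : ∀ x k → (- x) ^ k ≡ -1ℤ ^ k * x ^ k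
neg-^ x zero    = refl
neg-^ x (suc k) = trans (cong (- x *_) (neg-^ x k)) (regroup x (-1ℤ ^ k) (x ^ k))
  where regroup : ∀ x s p → - x * (s * p) ≡ -1ℤ * s * (x * p)
        regroup = solve-∀

-1^[b+c+2d] : ∀ b c d → -1ℤ ^ (b ℕ.+ c ℕ.+ 2 ℕ.* d) ≡ -1ℤ ^ b * -1ℤ ^ c
-1^[b+c+2d] b c d = begin
  -1ℤ ^ (b ℕ.+ c ℕ.+ 2 ℕ.* d)          ≡⟨ ℤP.^-distribˡ-+-* -1ℤ (b ℕ.+ c) (2 ℕ.* d) ⟩
  -1ℤ ^ (b ℕ.+ c) * -1ℤ ^ (2 ℕ.* d)    ≡⟨ cong₂ _*_ (ℤP.^-distribˡ-+-* -1ℤ b c) (trans (sym (ℤP.^-*-assoc -1ℤ 2 d)) (ℤP.^-zeroˡ d)) ⟩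
  -1ℤ ^ b * -1ℤ ^ c * 1ℤ              ≡⟨ ℤP.*-identityʳ _ ⟩
  -1ℤ ^ b * -1ℤ ^ c                    ∎
  where open ≡-Reasoning

multinomial-kindProduct≡term : ∀ n q → qsum q ≡ n → + multinomial n q * kindProduct q (kindWeight q) ≡ term n q
multinomial-kindProduct≡term n q@(a , b , c , d) qsum≡ = begin
  + coeff * (g₀₀ ^ a * (- g₁₀) ^ b * (- g₀₁) ^ c * g₁₁ ^ d)
    ≡⟨ cong₂ (λ x y → + coeff * (g₀₀ ^ a * x * y * g₁₁ ^ d)) (neg-^ g₁₀ b) (neg-^ g₀₁ c) ⟩
  + coeff * (g₀₀ ^ a * (-1ℤ ^ b * g₁₀ ^ b) * (-1ℤ ^ c * g₀₁ ^ c) * g₁₁ ^ d)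
    ≡⟨ regroup (+ coeff) (g₀₀ ^ a) (-1ℤ ^ b) (g₁₀ ^ b) (-1ℤ ^ c) (g₀₁ ^ c) (g₁₁ ^ d) ⟩
  -1ℤ ^ b * -1ℤ ^ c * + coeff * g₀₀ ^ a * g₁₀ ^ b * g₀₁ ^ c * g₁₁ ^ d
    ≡⟨ cong₂ (λ s m′ → s * + m′ * g₀₀ ^ a * g₁₀ ^ b * g₀₁ ^ c * g₁₁ ^ d)
             (sym (-1^[b+c+2d] b c d)) (sym (multinomial4≡multinomial n a b c d qsum≡)) ⟩
  term n q
    ∎
  where
  open ≡-Reasoning
  coeff = multinomial n q
  g₀₀ = g (+ a - 1ℤ) (+ b) (+ c) (+ d + 1ℤ)
  g₁₀ = g (+ a) (+ b - 1ℤ) (+ c) (+ d + 1ℤ)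
  g₀₁ = g (+ a) (+ b) (+ c - 1ℤ) (+ d + 1ℤ)
  g₁₁ = g (+ a) (+ b) (+ c) (+ d)
  regroup : ∀ m p₀₀ s₁₀ p₁₀ s₀₁ p₀₁ p₁₁ →
            m * (p₀₀ * (s₁₀ * p₁₀) * (s₀₁ * p₀₁) * p₁₁) ≡ s₁₀ * s₀₁ * m * p₀₀ * p₁₀ * p₀₁ * p₁₁
  regroup = solve-∀

-- The identity holds for n = 0 as well.
mainTheorem2 : (n : ℕ) → 1 ≤ n → + R₃ n ≡ formula n
mainTheorem2 n _ = begin
  + R₃ n
    ≡⟨ length-filter isReducedLatin? (allMatrices 3 n) ⟩
  ∑[ M ∈ allMatrices 3 n ] 𝟙 (isReducedLatin? M)
    ≡⟨ ∑ₗ-cong (allMatrices 3 n) 𝟙-reducedLatin ⟩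
  ∑[ M ∈ allMatrices 3 n ] ∑[ T ∈ subsets n ] ∑[ S ∈ subsets n ] signedColumns T S M
    ≡⟨ trans (∑ₗ-comm (allMatrices 3 n) (subsets n) _) (∑ₗ-cong (subsets n) λ T → ∑ₗ-comm (allMatrices 3 n) (subsets n) _) ⟩
  ∑[ T ∈ subsets n ] ∑[ S ∈ subsets n ] ∑[ M ∈ allMatrices 3 n ] signedColumns T S M
    ≡⟨ ∑ₗ-cong (subsets n) (λ T → ∑ₗ-cong (subsets n) λ S → trans (∑-signedColumns T S) (signedColumnValues-byKind T S)) ⟩
  ∑[ T ∈ subsets n ] ∑[ S ∈ subsets n ] weight (kindCount T S)
    ≡⟨ ∑-subsetPairs-byKind n weight ⟩
  ∑[ q ∈ compositions4 n ] (+ multinomial n q * weight q)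
    ≡⟨ ∑-compositions4-cong n (multinomial-kindProduct≡term n) ⟩
  formula n
    ∎
  where
  open ≡-Reasoning
  weight : Quad → ℤ
  weight q = kindProduct q (kindWeight q)
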